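{- Let $r$ be a power of the prime $p$ and let $2<m<r-1$. Let $h$ be a positive integer and $f$ a nonnegative integer with $h\mid\gcd(r-1,m-2,p^f-1)$ and $p^f\mid\gcd(r,m-1)$. Suppose there is a subset $A\subseteq\mathbb{F}_r$ with $|A|=m-1$ and a subgroup $G$ of $\mathrm{AGL}(1,r)$ of order $hp^f$ such that (i) $A$ is invariant under $G$ and, for every nonidentity element of $G$ of the form $T_{a,s}$, one has $a\in A$; and (ii) $A$ is not invariant under any strictly larger subgroup of $\mathrm{AGL}(1,r)$ having property (i). Let $L=\mathbb{F}_r$, let $x\in\mathbb{F}_{r^2}\setminus\mathbb{F}_r$, and consider the Desarguesian net of order $r$ and degree $m$ in which $x^\perp\cap L=A$ (i.e. whose directions are $\mathbb{F}_r^*$ together with the classes $(x-a)\mathbb{F}_r^*$, $a\in A$). Then $|C_{x,L}|=m-1+hp^f$.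
   Context: $\mathrm{AGL}(1,r)$ is the group of maps $z\mapsto cz+d$ on $\mathbb{F}_r$ with $c\in\mathbb{F}_r^*$, $d\in\mathbb{F}_r$ (these act also on $\mathbb{F}_{r^2}$ by the same formula). For $a\in\mathbb{F}_r$ and $s\in\mathbb{F}_r^*$, $T_{a,s}$ denotes the homothety $z\mapsto a+s(z-a)$; the nonidentity elements with a fixed point are exactly the $T_{a,s}$ with $s\neq1$. A Desarguesian net of order $r$ and degree $m$: point set $\mathbb{F}_{r^2}$; fix $S\subseteq\mathbb{F}_{r^2}^*$, a union of $m$ cosets of $\mathbb{F}_r^*$; lines are $a+d\,\mathbb{F}_r$ with $d\in S$; the collinearity graph has vertex set $\mathbb{F}_{r^2}$, distinct vertices adjacent iff their difference lies in $S$. For a vertex $y$, $y^\perp$ is $\{y\}$ together with its neighbours. For a line $L$ and a point $x\notin L$, $C_{x,L}$ denotes the unique maximal clique containing $\{x\}\cup(x^\perp\cap L)$ (existence and uniqueness are known). -}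

module Defs where

open import Level using (0ℓ)
open import Data.Nat as ℕ using (ℕ; zero; suc)
open import Data.Bool using (Bool; true; false)
open import Data.Product using (Σ; _×_; _,_; proj₁; proj₂)
open import Data.Sum using (_⊎_)
open import Data.List using (List; length; filterᵇ; cartesianProduct)
open import Data.List.Membership.Propositional using (_∈_)
open import Data.List.Relation.Unary.Unique.Propositional using (Unique)
open import Relation.Binary.PropositionalEquality using (_≡_; _≢_)
open import Relation.Binary.Definitions using (DecidableEquality)
open import Algebra.Structures using (IsCommutativeRing)

record FiniteField : Set₁ where
  infixl 7 _*_
  infixl 6 _+_
  field
    Carrier : Set
    _+_ _*_ : Carrier → Carrier → Carrier
    -_      : Carrier → Carrier
    0# 1#   : Carrier
    isCommutativeRing : IsCommutativeRing _≡_ _+_ _*_ -_ 0# 1#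
    _⁻¹     : Carrier → Carrier
    inverse : ∀ x → x ≢ 0# → x * (x ⁻¹) ≡ 1#
    0≢1     : 0# ≢ 1#
    _≟_     : DecidableEquality Carrier
    elems   : List Carrier
    complete : ∀ x → x ∈ elems
    unique  : Unique elems

module FF (K : FiniteField) where
  open FiniteField K public

  pow : Carrier → ℕ → Carrier
  pow z zero    = 1#
  pow z (suc n) = z * pow z n

  count : (Carrier → Bool) → ℕ
  count P = length (filterᵇ P elems)

  -- AGL(1,r) elements are represented by pairs (c , d), acting as z ↦ c z + d
  Pair : Set
  Pair = Carrier × Carrier

  countPairs : (Pair → Bool) → ℕ
  countPairs P = length (filterᵇ P (cartesianProduct elems elems))

  apply : Pair → Carrier → Carrier
  apply (c , d) z = c * z + d

  idMap : Pair
  idMap = (1# , 0#)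

  compose : Pair → Pair → Pair
  compose (c , d) (c' , d') = (c * c' , c * d' + d)

  invMap : Pair → Pair
  invMap (c , d) = (c ⁻¹ , - (c ⁻¹ * d))

  module Sub (r : ℕ) where
    -- the subfield F_r of F_{r²}: elements with z^r = z
    InFr : Carrier → Set
    InFr z = pow z r ≡ z

    IsAGL : Pair → Set
    IsAGL (c , d) = InFr c × InFr d × c ≢ 0#

    IsSubgroupAGL : (Pair → Bool) → Set
    IsSubgroupAGL G =
      (∀ g → G g ≡ true → IsAGL g) ×
      G idMap ≡ true ×
      (∀ g g' → G g ≡ true → G g' ≡ true → G (compose g g') ≡ true) ×
      (∀ g → G g ≡ true → G (invMap g) ≡ true)

    -- property (i): A is G-invariant and every nonidentity element of G
    -- with a fixed point a ∈ F_r (i.e. of the form T_{a,s}, s ≠ 1) has a ∈ A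
    PropertyI : (Pair → Bool) → (Carrier → Bool) → Set
    PropertyI G A =
      (∀ g → G g ≡ true → ∀ z → A z ≡ true → A (apply g z) ≡ true) ×
      (∀ g → G g ≡ true → g ≢ idMap → ∀ a → InFr a → apply g a ≡ a → A a ≡ true)

    module Net (A : Carrier → Bool) (x : Carrier) where
      InS : Carrier → Set
      InS w = w ≢ 0# ×
        (InFr w ⊎ Σ Carrier (λ a → A a ≡ true ×
                    Σ Carrier (λ t → InFr t × t ≢ 0# × w ≡ t * (x + - a))))

      Adj : Carrier → Carrier → Set
      Adj u v = u ≢ v × InS (u + - v)

      IsClique : (Carrier → Bool) → Set
      IsClique C = ∀ u v → C u ≡ true → C v ≡ true → u ≢ v → Adj u v

      IsMaximalClique : (Carrier → Bool) → Set
      IsMaximalClique C = IsClique C ×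
        (∀ D → IsClique D → (∀ z → C z ≡ true → D z ≡ true) →
           ∀ z → D z ≡ true → C z ≡ true)

      -- C contains {x} ∪ (x^⊥ ∩ L), where L = F_r
      ContainsXAndXperpL : (Carrier → Bool) → Set
      ContainsXAndXperpL C = C x ≡ true ×
        (∀ z → InFr z → (z ≡ x ⊎ Adj x z) → C z ≡ true)

{-# OPTIONS --safe #-}
module Submission where

-- Write F for the subfield F_r = {z | z ^ r ≡ z} of K; it is closed under + because K has
-- characteristic p (as |K| = p²ᵏ), so z ↦ z ^ r is additive.  Call an affine map g ∈ AGL(1, r)
-- admissible if it stabilises A and every fixed point in F of g ≢ id lies in A.  Admissible maps
-- form a group: if two homotheties with centres a₁, a₂ stabilise A, their commutator is a
-- translation stabilising A, and rescaling shows that a₁ - a₂ is a period of A; hence the fixed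
-- point of a product of admissible maps differs from the centre of a factor by a period, and lies
-- in A.  The clique C meets F exactly in A.  A point y ∈ C outside F is adjacent to x, so y = g x
-- for a translation or a homothety centred in A, and g stabilises A since g x is adjacent to all
-- of A (a counting argument); conversely C ∪ {g x} is a clique for admissible g, so g x ∈ C.
-- Hence {g ∈ AGL(1, r) | g x ∈ C} is the group of admissible maps; it has property (i) and
-- contains G, so it equals G by maximality.  Since 1 and x are independent over F, g ↦ g x is
-- injective, and |C| = |A| + |G|.

open import Defs
open import Level using (0ℓ)
open import Algebra.Bundles using (CommutativeRing; CommutativeSemiring; RawRing)
open import Data.Bool using (Bool; true; false; T; _∧_; _∨_; not)
open import Data.Bool.Properties using (T-≡; ∨-zeroʳ; ∧-conicalˡ; ∧-conicalʳ; ∧-zeroʳ; ∧-identityʳ)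
open import Data.Empty using (⊥-elim)
open import Data.Fin using (fromℕ; inject₁) renaming (zero to fzero; suc to fsuc)
open import Data.Fin.Properties using (toℕ-fromℕ; toℕ-inject₁; toℕ<n)
open import Data.List using (List; []; _∷_; length; map; foldr; filterᵇ; cartesianProduct)
open import Data.List.Properties using (length-map; filter-complete; filter-≐)
open import Data.List.Membership.Propositional using (_∈_)
open import Data.List.Membership.Propositional.Properties
  using (∈-map⁺; ∈-map⁻; ∈-filter⁺; ∈-filter⁻; ∈-cartesianProduct⁺)
open import Data.List.Membership.Propositional.Properties.WithK using (unique∧set⇒bag)
open import Data.List.Relation.Binary.BagAndSetEquality using (∼bag⇒↭)
open import Data.List.Relation.Binary.Permutation.Propositional using (_↭_; ↭⇒↭ₛ)
open import Data.List.Relation.Binary.Permutation.Propositional.Properties using (↭-length)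
open import Data.List.Relation.Binary.Permutation.Setoid.Properties using (foldr-commMonoid)
import Data.List.Relation.Unary.All as All
import Data.List.Relation.Unary.All.Properties as All
open import Data.List.Relation.Unary.Any using (here; there)
open import Data.List.Relation.Unary.AllPairs using ([]; _∷_)
open import Data.List.Relation.Unary.Unique.Propositional using (Unique)
import Data.List.Relation.Unary.Unique.Propositional.Properties as Unique
open import Data.Maybe using (Maybe; just; nothing)
open import Data.Nat as ℕ using (ℕ; zero; suc; z≤n; s≤s)
open import Data.Nat.Base using (nonTrivial⇒n>1)
open import Data.Nat.Properties using (+-suc; n∸n≡0; ^-monoʳ-<; m+[n∸m]≡n)
open import Data.Nat.Divisibility using (_∣_; divides; ∣⇒≤)
open import Data.Nat.GCD using (gcd)
open import Data.Nat.Primality using (Prime; euclidsLemma; ¬prime[0]; prime⇒nonTrivial)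
open import Data.Product using (_×_; _,_; proj₁; proj₂; ∃-syntax)
open import Data.Sum using (_⊎_; inj₁; inj₂)
open import Data.Vec.Functional using (Vector; replicate; init; last)
open import Function.Bundles using (Equivalence; mk⇔)
open import Relation.Binary.PropositionalEquality as ≡
  using (_≡_; _≢_; refl; sym; trans; cong; cong₂; subst; ≢-sym; module ≡-Reasoning)
open import Relation.Nullary using (¬_; Dec; yes; no; does; ¬?; _×-dec_; contradiction)
open import Relation.Nullary.Decidable using (T?; dec-true; dec-false)

-- Counting in finite lists

bool-ext : ∀ {b c : Bool} → (b ≡ true → c ≡ true) → (c ≡ true → b ≡ true) → b ≡ c
bool-ext {false} {false} _   _   = refl
bool-ext {false} {true}  _   c⇒b = c⇒b refl
bool-ext {true}          b⇒c _   = sym (b⇒c refl)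

does≡true⇒ : ∀ {P : Set} (P? : Dec P) → does P? ≡ true → P
does≡true⇒ (yes p) _ = p

not-does≡true⇒¬ : ∀ {P : Set} (P? : Dec P) → not (does P?) ≡ true → ¬ P
not-does≡true⇒¬ (no ¬p) _ = ¬p

module _ {A : Set} (P : A → Bool) where

  ∈-filterᵇ⁺ : ∀ {xs z} → z ∈ xs → P z ≡ true → z ∈ filterᵇ P xs
  ∈-filterᵇ⁺ z∈xs Pz = ∈-filter⁺ (λ z → T? (P z)) z∈xs (Equivalence.from T-≡ Pz)

  ∈-filterᵇ⁻ : ∀ xs {z} → z ∈ filterᵇ P xs → z ∈ xs × P z ≡ true
  ∈-filterᵇ⁻ xs z∈ with ∈-filter⁻ (λ z → T? (P z)) z∈
  ... | z∈xs , Pz = z∈xs , Equivalence.to T-≡ Pz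

  filterᵇ-cong : ∀ {Q : A → Bool} → (∀ z → P z ≡ Q z) → ∀ xs → filterᵇ P xs ≡ filterᵇ Q xs
  filterᵇ-cong {Q} P≗Q = filter-≐ (λ z → T? (P z)) (λ z → T? (Q z))
    ((λ {z} → subst T (P≗Q z)) , (λ {z} → subst T (sym (P≗Q z))))

  length-filterᵇ-split : ∀ (Q : A → Bool) xs →
    length (filterᵇ P xs) ≡
    length (filterᵇ (λ z → P z ∧ Q z) xs) ℕ.+ length (filterᵇ (λ z → P z ∧ not (Q z)) xs)
  length-filterᵇ-split Q [] = refl
  length-filterᵇ-split Q (x ∷ xs) with P x | Q x
  ... | true  | true  = cong suc (length-filterᵇ-split Q xs)
  ... | true  | false = trans (cong suc (length-filterᵇ-split Q xs)) (sym (+-suc _ _))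
  ... | false | _     = length-filterᵇ-split Q xs

module _ {A B : Set} (f : A → B) where

  InjectiveOn : List A → Set
  InjectiveOn xs = ∀ {a a′} → a ∈ xs → a′ ∈ xs → f a ≡ f a′ → a ≡ a′

  map⁺-injectiveOn : ∀ {xs} → InjectiveOn xs → Unique xs → Unique (map f xs)
  map⁺-injectiveOn {[]}     _   []           = []
  map⁺-injectiveOn {x ∷ xs} inj (x∉xs ∷ uxs) =
    All.map⁺ (All.tabulate (λ a∈xs fx≡fa → All.lookup x∉xs a∈xs (inj (here refl) (there a∈xs) fx≡fa)))
    ∷ map⁺-injectiveOn (λ a∈ a′∈ → inj (there a∈) (there a′∈)) uxs

  length-≡-of-bijection : ∀ {xs ys} → Unique xs → Unique ys → InjectiveOn xs →
    (∀ {a} → a ∈ xs → f a ∈ ys) → (∀ {b} → b ∈ ys → ∃[ a ] a ∈ xs × f a ≡ b) →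
    length xs ≡ length ys
  length-≡-of-bijection {xs} {ys} uxs uys inj into onto = begin
    length xs          ≡⟨ sym (length-map f xs) ⟩
    length (map f xs)  ≡⟨ ↭-length (∼bag⇒↭ (unique∧set⇒bag (map⁺-injectiveOn inj uxs) uys (mk⇔ to from))) ⟩
    length ys          ∎
    where
    open ≡-Reasoning
    to : ∀ {b} → b ∈ map f xs → b ∈ ys
    to b∈ with ∈-map⁻ f b∈
    ... | a , a∈xs , refl = into a∈xs
    from : ∀ {b} → b ∈ ys → b ∈ map f xs
    from b∈ with onto b∈
    ... | a , a∈xs , refl = ∈-map⁺ f a∈xs

module _ {A : Set} {xs : List A} (unique : Unique xs) (complete : ∀ z → z ∈ xs) where

  ⊆-image⇒image-⊆ : ∀ (P : A → Bool) (f : A → A) → (∀ {a a′} → f a ≡ f a′ → a ≡ a′) →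
    (∀ a → P a ≡ true → ∃[ b ] P b ≡ true × f b ≡ a) → ∀ b → P b ≡ true → P (f b) ≡ true
  ⊆-image⇒image-⊆ P f f-injective ⊆image b Pb =
    proj₂ (∈-filterᵇ⁻ P∘f S (subst (b ∈_) (sym S′≡S) (∈-filterᵇ⁺ P (complete b) Pb)))
    where
    P∘f : A → Bool
    P∘f z = P (f z)
    S = filterᵇ P xs
    S′ = filterᵇ P∘f S
    unique-S : Unique S
    unique-S = Unique.filter⁺ (λ z → T? (P z)) unique
    into : ∀ {a} → a ∈ S′ → f a ∈ S
    into a∈S′ = ∈-filterᵇ⁺ P (complete _) (proj₂ (∈-filterᵇ⁻ P∘f S a∈S′))
    onto : ∀ {a} → a ∈ S → ∃[ b ] b ∈ S′ × f b ≡ a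
    onto {a} a∈S with ⊆image a (proj₂ (∈-filterᵇ⁻ P xs a∈S))
    ... | b , Pb , fb≡a =
      b , ∈-filterᵇ⁺ P∘f (∈-filterᵇ⁺ P (complete b) Pb) (trans (cong P fb≡a) (proj₂ (∈-filterᵇ⁻ P xs a∈S)))
        , fb≡a
    S′≡S : S′ ≡ S
    S′≡S = filter-complete (λ z → T? (P∘f z))
      (length-≡-of-bijection f (Unique.filter⁺ (λ z → T? (P∘f z)) unique-S) unique-S (λ _ _ → f-injective) into onto)

-- Algebra.Solver.Ring.Simple takes the coefficients from the ring itself, whose equality does not
-- compute in an abstract ring; here they are integers, a pair (m , n) standing for m - n.
module IntegerCoefficientSolver {c ℓ} (R : CommutativeRing c ℓ) where
  open CommutativeRing R renaming (refl to ≈-refl; sym to ≈-sym; trans to ≈-trans)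
  open import Algebra.Properties.Ring ring
    using (-‿+-comm; -‿involutive; -‿distribˡ-*; -‿distribʳ-*; -0#≈0#)
  open import Algebra.Properties.CommutativeSemigroup +-commutativeSemigroup using (interchange)
  open import Algebra.Properties.Semiring.Mult.TCOptimised semiring
    using (1+×; ×-homo-+; ×1-homo-*) renaming (_×_ to _·_)
  open import Algebra.Solver.Ring.AlmostCommutativeRing using (fromCommutativeRing; _-Raw-AlmostCommutative⟶_)
  open import Relation.Binary.Reasoning.Setoid setoid

  private
    -- Keeping one component zero makes equal integers equal as pairs, so that
    -- normal forms of equal polynomials coincide.
    reduce : ℕ × ℕ → ℕ × ℕ
    reduce (m , n) = (m ℕ.∸ n , n ℕ.∸ m)

    ℤ-rawRing : RawRing _ _
    ℤ-rawRing = record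
      { Carrier = ℕ × ℕ
      ; _≈_ = _≡_
      ; _+_ = λ { (m , n) (m′ , n′) → reduce (m ℕ.+ m′ , n ℕ.+ n′) }
      ; _*_ = λ { (m , n) (m′ , n′) → reduce (m ℕ.* m′ ℕ.+ n ℕ.* n′ , m ℕ.* n′ ℕ.+ n ℕ.* m′) }
      ; -_ = λ { (m , n) → (n , m) }
      ; 0# = (0 , 0)
      ; 1# = (1 , 0)
      }

    embed : ℕ × ℕ → Carrier
    embed (m , zero) = m · 1#
    embed (zero , suc n) = - (suc n · 1#)
    embed (suc m , suc n) = embed (m , n)

    embed-difference : ∀ m n → embed (m , n) ≈ m · 1# - n · 1#
    embed-difference m zero = ≈-sym (≈-trans (+-congˡ -0#≈0#) (+-identityʳ _))
    embed-difference zero (suc n) = ≈-sym (+-identityˡ _)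
    embed-difference (suc m) (suc n) = begin
      embed (m , n)                     ≈⟨ embed-difference m n ⟩
      m · 1# - n · 1#                   ≈⟨ +-congˡ (≈-sym (+-identityˡ _)) ⟩
      m · 1# + (0# - n · 1#)            ≈⟨ +-congˡ (+-congʳ (≈-sym (-‿inverseʳ 1#))) ⟩
      m · 1# + ((1# - 1#) - n · 1#)     ≈⟨ +-congˡ (+-assoc 1# (- 1#) _) ⟩
      m · 1# + (1# + (- 1# - n · 1#))   ≈⟨ ≈-sym (+-assoc _ _ _) ⟩
      (m · 1# + 1#) + (- 1# - n · 1#)   ≈⟨ +-cong (+-comm _ _) (-‿+-comm 1# _) ⟩
      (1# + m · 1#) - (1# + n · 1#)     ≈⟨ +-cong (≈-sym (1+× m 1#)) (-‿cong (≈-sym (1+× n 1#))) ⟩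
      suc m · 1# - suc n · 1#           ∎

    embed-reduce : ∀ m n → embed (reduce (m , n)) ≈ embed (m , n)
    embed-reduce zero    zero    = ≈-refl
    embed-reduce zero    (suc n) = ≈-refl
    embed-reduce (suc m) zero    = ≈-refl
    embed-reduce (suc m) (suc n) = embed-reduce m n

    differences-≈ : ∀ {a b a′ b′} → a + b′ ≈ b + a′ → a - b ≈ a′ - b′
    differences-≈ {a} {b} {a′} {b′} a+b′≈b+a′ = begin
      a - b                   ≈⟨ ≈-sym (+-identityʳ _) ⟩
      (a - b) + 0#            ≈⟨ +-congˡ (≈-sym (-‿inverseʳ b′)) ⟩
      (a - b) + (b′ - b′)     ≈⟨ interchange _ _ _ _ ⟩
      (a + b′) + (- b - b′)   ≈⟨ +-congʳ a+b′≈b+a′ ⟩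
      (b + a′) + (- b - b′)   ≈⟨ interchange _ _ _ _ ⟩
      (b - b) + (a′ - b′)     ≈⟨ +-congʳ (-‿inverseʳ b) ⟩
      0# + (a′ - b′)          ≈⟨ +-identityˡ _ ⟩
      a′ - b′                 ∎

    differences-* : ∀ a b a′ b′ → (a - b) * (a′ - b′) ≈ (a * a′ + b * b′) - (a * b′ + b * a′)
    differences-* a b a′ b′ = begin
      (a - b) * (a′ - b′)                             ≈⟨ distribʳ _ a (- b) ⟩
      a * (a′ - b′) + - b * (a′ - b′)
        ≈⟨ +-cong (distribˡ a a′ (- b′)) (distribˡ (- b) a′ (- b′)) ⟩
      (a * a′ + a * - b′) + (- b * a′ + - b * - b′)
        ≈⟨ +-cong (+-congˡ (≈-sym (-‿distribʳ-* a b′)))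
                  (+-cong (≈-sym (-‿distribˡ-* b a′)) minus-times-minus) ⟩
      (a * a′ - a * b′) + (- (b * a′) + b * b′)       ≈⟨ +-congˡ (+-comm _ _) ⟩
      (a * a′ - a * b′) + (b * b′ - b * a′)           ≈⟨ interchange _ _ _ _ ⟩
      (a * a′ + b * b′) + (- (a * b′) - b * a′)       ≈⟨ +-congˡ (-‿+-comm _ _) ⟩
      (a * a′ + b * b′) - (a * b′ + b * a′)           ∎
      where
      minus-times-minus : - b * - b′ ≈ b * b′
      minus-times-minus =
        ≈-trans (≈-sym (-‿distribˡ-* b (- b′)))
                (≈-trans (-‿cong (≈-sym (-‿distribʳ-* b b′))) (-‿involutive _))

    embed-+ : ∀ m n m′ n′ → embed (m ℕ.+ m′ , n ℕ.+ n′) ≈ embed (m , n) + embed (m′ , n′)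
    embed-+ m n m′ n′ = begin
      embed (m ℕ.+ m′ , n ℕ.+ n′)
        ≈⟨ embed-difference (m ℕ.+ m′) (n ℕ.+ n′) ⟩
      (m ℕ.+ m′) · 1# - (n ℕ.+ n′) · 1#
        ≈⟨ +-cong (×-homo-+ 1# m m′) (-‿cong (×-homo-+ 1# n n′)) ⟩
      (m · 1# + m′ · 1#) - (n · 1# + n′ · 1#)      ≈⟨ +-congˡ (≈-sym (-‿+-comm _ _)) ⟩
      (m · 1# + m′ · 1#) + (- (n · 1#) - n′ · 1#)  ≈⟨ interchange _ _ _ _ ⟩
      (m · 1# - n · 1#) + (m′ · 1# - n′ · 1#)
        ≈⟨ ≈-sym (+-cong (embed-difference m n) (embed-difference m′ n′)) ⟩
      embed (m , n) + embed (m′ , n′)              ∎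

    embed-* : ∀ m n m′ n′ →
              embed (m ℕ.* m′ ℕ.+ n ℕ.* n′ , m ℕ.* n′ ℕ.+ n ℕ.* m′) ≈ embed (m , n) * embed (m′ , n′)
    embed-* m n m′ n′ = begin
      embed (m ℕ.* m′ ℕ.+ n ℕ.* n′ , m ℕ.* n′ ℕ.+ n ℕ.* m′)
        ≈⟨ embed-+ (m ℕ.* m′) (m ℕ.* n′) (n ℕ.* n′) (n ℕ.* m′) ⟩
      embed (m ℕ.* m′ , m ℕ.* n′) + embed (n ℕ.* n′ , n ℕ.* m′)
        ≈⟨ +-cong (embed-difference (m ℕ.* m′) (m ℕ.* n′))
                  (embed-difference (n ℕ.* n′) (n ℕ.* m′)) ⟩
      ((m ℕ.* m′) · 1# - (m ℕ.* n′) · 1#) + ((n ℕ.* n′) · 1# - (n ℕ.* m′) · 1#)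
        ≈⟨ +-cong (+-cong (×1-homo-* m m′) (-‿cong (×1-homo-* m n′)))
                  (+-cong (×1-homo-* n n′) (-‿cong (×1-homo-* n m′))) ⟩
      (M * M′ - M * N′) + (N * N′ - N * M′)        ≈⟨ interchange _ _ _ _ ⟩
      (M * M′ + N * N′) + (- (M * N′) - N * M′)    ≈⟨ +-congˡ (-‿+-comm _ _) ⟩
      (M * M′ + N * N′) - (M * N′ + N * M′)        ≈⟨ ≈-sym (differences-* M N M′ N′) ⟩
      (M - N) * (M′ - N′)
        ≈⟨ ≈-sym (*-cong (embed-difference m n) (embed-difference m′ n′)) ⟩
      embed (m , n) * embed (m′ , n′)              ∎
      where
      M = m · 1#
      N = n · 1#
      M′ = m′ · 1#
      N′ = n′ · 1#

    embed-neg : ∀ m n → embed (n , m) ≈ - embed (m , n)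
    embed-neg m n = begin
      embed (n , m)                ≈⟨ embed-difference n m ⟩
      n · 1# - m · 1#              ≈⟨ +-comm _ _ ⟩
      - (m · 1#) + n · 1#          ≈⟨ +-congˡ (≈-sym (-‿involutive _)) ⟩
      - (m · 1#) - - (n · 1#)      ≈⟨ -‿+-comm _ _ ⟩
      - (m · 1# - n · 1#)          ≈⟨ -‿cong (≈-sym (embed-difference m n)) ⟩
      - embed (m , n)              ∎

    homomorphism : ℤ-rawRing -Raw-AlmostCommutative⟶ fromCommutativeRing R
    homomorphism = record
      { ⟦_⟧ = embed
      ; +-homo = λ { (m , n) (m′ , n′) → ≈-trans (embed-reduce (m ℕ.+ m′) (n ℕ.+ n′)) (embed-+ m n m′ n′) }
      ; *-homo = λ { (m , n) (m′ , n′) →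
          ≈-trans (embed-reduce (m ℕ.* m′ ℕ.+ n ℕ.* n′) (m ℕ.* n′ ℕ.+ n ℕ.* m′)) (embed-* m n m′ n′) }
      ; -‿homo = λ { (m , n) → embed-neg m n }
      ; 0-homo = ≈-refl
      ; 1-homo = ≈-refl
      }

    embed-≟ : ∀ u v → Maybe (embed u ≈ embed v)
    embed-≟ (m , n) (m′ , n′) with m ℕ.+ n′ ℕ.≟ n ℕ.+ m′
    ... | no _ = nothing
    ... | yes m+n′≡n+m′ = just (begin
      embed (m , n)        ≈⟨ embed-difference m n ⟩
      m · 1# - n · 1#      ≈⟨ differences-≈ m+n′≈n+m′ ⟩
      m′ · 1# - n′ · 1#    ≈⟨ ≈-sym (embed-difference m′ n′) ⟩
      embed (m′ , n′)      ∎)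
      where
      m+n′≈n+m′ : m · 1# + n′ · 1# ≈ n · 1# + m′ · 1#
      m+n′≈n+m′ = begin
        m · 1# + n′ · 1#    ≈⟨ ×-homo-+ 1# m n′ ⟨
        (m ℕ.+ n′) · 1#     ≡⟨ cong (_· 1#) m+n′≡n+m′ ⟩
        (n ℕ.+ m′) · 1#     ≈⟨ ×-homo-+ 1# n m′ ⟩
        n · 1# + m′ · 1#    ∎

  open import Algebra.Solver.Ring ℤ-rawRing (fromCommutativeRing R) homomorphism embed-≟ public

  :0 :1 : ∀ {n} → Polynomial n
  :0 = con (0 , 0)
  :1 = con (1 , 0)

-- The Frobenius endomorphism

module _ where
  open import Data.Nat using (_+_; _*_; _<_)
  open import Data.Nat.Combinatorics using (_C_; nC1≡n; nCk+nC[k+1]≡[n+1]C[k+1])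
  open import Data.Nat.Properties using (*-comm; *-distribˡ-+; *-zeroʳ; *-identityˡ; *-identityʳ; <⇒≱)
  open import Data.Nat.Solver using (module +-*-Solver)
  open +-*-Solver using (solve; _:+_; _:*_; _:=_; con)

  [k+1]*[n+1]C[k+1]≡[n+1]*nCk : ∀ n k → suc k * (suc n C suc k) ≡ suc n * (n C k)
  [k+1]*[n+1]C[k+1]≡[n+1]*nCk zero    zero    = refl
  [k+1]*[n+1]C[k+1]≡[n+1]*nCk zero    (suc k) = *-zeroʳ (2 + k)
  [k+1]*[n+1]C[k+1]≡[n+1]*nCk (suc n) zero    =
    trans (*-identityˡ _) (trans (nC1≡n (2 + n)) (sym (*-identityʳ (2 + n))))
  [k+1]*[n+1]C[k+1]≡[n+1]*nCk (suc n) (suc k) = begin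
    (2 + k) * ((2 + n) C (2 + k))          ≡⟨ cong ((2 + k) *_) (sym (pascal (1 + n) (1 + k))) ⟩
    (2 + k) * (X + Y)                      ≡⟨ solve 3 (λ k X Y → (con 2 :+ k) :* (X :+ Y)
                                                 := X :+ ((con 1 :+ k) :* X :+ (con 2 :+ k) :* Y)) refl k X Y ⟩
    X + ((1 + k) * X + (2 + k) * Y)        ≡⟨ cong₂ (λ u v → X + (u + v)) (absorb n k) (absorb n (1 + k)) ⟩
    X + ((1 + n) * (n C k) + (1 + n) * (n C (1 + k)))
                                           ≡⟨ cong (X +_) (sym (*-distribˡ-+ (1 + n) (n C k) (n C (1 + k)))) ⟩
    X + (1 + n) * (n C k + n C (1 + k))    ≡⟨ cong (λ w → X + (1 + n) * w) (pascal n k) ⟩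
    X + (1 + n) * X                        ∎
    where
    open ≡-Reasoning
    absorb = [k+1]*[n+1]C[k+1]≡[n+1]*nCk
    pascal = nCk+nC[k+1]≡[n+1]C[k+1]
    X = (1 + n) C (1 + k)
    Y = (1 + n) C (2 + k)

  p∣pCk : ∀ {p k} → Prime p → 0 < k → k < p → p ∣ p C k
  p∣pCk {suc n} {suc k} p-prime _ k<p
    with euclidsLemma (suc k) (suc n C suc k) p-prime
           (divides (n C k) (trans ([k+1]*[n+1]C[k+1]≡[n+1]*nCk n k) (*-comm (suc n) (n C k))))
  ... | inj₂ p∣pCk = p∣pCk
  ... | inj₁ p∣k+1 = contradiction (∣⇒≤ p∣k+1) (<⇒≱ k<p)

module Frobenius {c ℓ} (S : CommutativeSemiring c ℓ) where
  open CommutativeSemiring S renaming (refl to ≈-refl; sym to ≈-sym; trans to ≈-trans)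
  open import Algebra.Properties.Semiring.Exp semiring using (_^_; ^-assocʳ; ^-congˡ)
  open import Algebra.Properties.Semiring.Mult semiring
    using (×-assoc-*; ×-congʳ; ×1-homo-*) renaming (_×_ to _·_)
  open import Algebra.Properties.Monoid.Sum +-monoid using (sum; sum-init-last; sum-cong-≋; sum-replicate-zero)
  open import Algebra.Properties.CommutativeSemiring.Binomial S using (theorem; binomialTerm)
  open import Data.Nat.Combinatorics using (_C_; nCn≡1)
  open import Relation.Binary.Reasoning.Setoid setoid

  sum≈last : ∀ {n} (t : Vector Carrier (suc n)) → (∀ i → t (inject₁ i) ≈ 0#) → sum t ≈ last t
  sum≈last {n} t init≈0 = begin
    sum t                          ≈⟨ sum-init-last t ⟩
    sum (init t) + last t          ≈⟨ +-congʳ (sum-cong-≋ init≈0) ⟩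
    sum (replicate n 0#) + last t  ≈⟨ +-congʳ (sum-replicate-zero n) ⟩
    0# + last t                    ≈⟨ +-identityˡ _ ⟩
    last t                         ∎

  p∣n⇒n·x≈0 : ∀ {p n} x → p · 1# ≈ 0# → p ∣ n → n · x ≈ 0#
  p∣n⇒n·x≈0 {p} x p·1≈0 (divides q refl) = begin
    (q ℕ.* p) · x                ≈⟨ ×-congʳ (q ℕ.* p) (*-identityˡ x) ⟨
    (q ℕ.* p) · (1# * x)         ≈⟨ ×-assoc-* (q ℕ.* p) 1# x ⟨
    ((q ℕ.* p) · 1#) * x         ≈⟨ *-congʳ (×1-homo-* q p) ⟩
    ((q · 1#) * (p · 1#)) * x    ≈⟨ *-congʳ (*-congˡ p·1≈0) ⟩
    ((q · 1#) * 0#) * x          ≈⟨ *-congʳ (zeroʳ _) ⟩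
    0# * x                       ≈⟨ zeroˡ x ⟩
    0#                           ∎

  -- All binomial coefficients but the outer two are divisible by p.
  frobenius : ∀ {p} → Prime p → p · 1# ≈ 0# → ∀ x y → (x + y) ^ p ≈ x ^ p + y ^ p
  frobenius {zero}  p-prime = contradiction p-prime ¬prime[0]
  frobenius {suc q} p-prime p·1≈0 x y = begin
    (x + y) ^ p                        ≈⟨ theorem p x y ⟩
    t fzero + sum (λ i → t (fsuc i))   ≈⟨ +-cong first (sum≈last (λ i → t (fsuc i)) middle) ⟩
    y ^ p + t (fromℕ p)                ≈⟨ +-congˡ final ⟩
    y ^ p + x ^ p                      ≈⟨ +-comm _ _ ⟩
    x ^ p + y ^ p                      ∎
    where
    p = suc q
    t = binomialTerm x y p
    first : t fzero ≈ y ^ p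
    first = ≈-trans (+-identityʳ _) (*-identityˡ _)
    middle : ∀ i → t (fsuc (inject₁ i)) ≈ 0#
    middle i = p∣n⇒n·x≈0 _ p·1≈0
      (p∣pCk p-prime (s≤s z≤n) (s≤s (subst (ℕ._< q) (sym (toℕ-inject₁ i)) (toℕ<n i))))
    final : t (fromℕ p) ≈ x ^ p
    final = begin
      t (fromℕ p)                     ≡⟨ cong (λ m → (p C m) · (x ^ m * y ^ (p ℕ.∸ m))) (toℕ-fromℕ p) ⟩
      (p C p) · (x ^ p * y ^ (p ℕ.∸ p)) ≡⟨ cong₂ (λ c m → c · (x ^ p * y ^ m)) (nCn≡1 p) (n∸n≡0 p) ⟩
      1 · (x ^ p * 1#)                ≈⟨ ≈-trans (+-identityʳ _) (*-identityʳ _) ⟩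
      x ^ p                           ∎

  frobenius-^ : ∀ {p} → Prime p → p · 1# ≈ 0# →
                ∀ k x y → (x + y) ^ (p ℕ.^ k) ≈ x ^ (p ℕ.^ k) + y ^ (p ℕ.^ k)
  frobenius-^ p-prime p·1≈0 zero x y = ≈-trans (*-identityʳ _) (≈-sym (+-cong (*-identityʳ x) (*-identityʳ y)))
  frobenius-^ {p} p-prime p·1≈0 (suc k) x y = begin
    (x + y) ^ (p ℕ.* pᵏ)                ≈⟨ ^-assocʳ (x + y) p pᵏ ⟨
    ((x + y) ^ p) ^ pᵏ                  ≈⟨ ^-congˡ pᵏ (frobenius p-prime p·1≈0 x y) ⟩
    (x ^ p + y ^ p) ^ pᵏ                ≈⟨ frobenius-^ p-prime p·1≈0 k (x ^ p) (y ^ p) ⟩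
    (x ^ p) ^ pᵏ + (y ^ p) ^ pᵏ         ≈⟨ +-cong (^-assocʳ x p pᵏ) (^-assocʳ y p pᵏ) ⟩
    x ^ (p ℕ.* pᵏ) + y ^ (p ℕ.* pᵏ)     ∎
    where pᵏ = p ℕ.^ k

-- Finite fields

module FieldProperties (K : FiniteField) where
  open FF K

  commutativeRing : CommutativeRing 0ℓ 0ℓ
  commutativeRing = record { isCommutativeRing = isCommutativeRing }

  open CommutativeRing commutativeRing public
    using (+-assoc; +-identityˡ; +-identityʳ; -‿inverseʳ; *-assoc; *-comm; *-identityˡ; *-identityʳ;
           zeroˡ; zeroʳ; semiring; commutativeSemiring; +-isCommutativeMonoid; _-_)
  open import Algebra.Properties.Ring (CommutativeRing.ring commutativeRing) public
    using (-0#≈0#; -‿involutive; x∙y⁻¹≈ε⇒x≈y)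
  open import Algebra.Properties.Semiring.Exp semiring public using (_^_)
  open import Algebra.Properties.Semiring.Mult semiring public using (×1-homo-*) renaming (_×_ to _·_)
  open IntegerCoefficientSolver commutativeRing public

  ⁻¹-inverseˡ : ∀ {x} → x ≢ 0# → x ⁻¹ * x ≡ 1#
  ⁻¹-inverseˡ {x} x≢0 = trans (*-comm _ x) (inverse x x≢0)

  ⁻¹-cancelˡ : ∀ {x} y → x ≢ 0# → x ⁻¹ * (x * y) ≡ y
  ⁻¹-cancelˡ {x} y x≢0 =
    trans (sym (*-assoc _ _ _)) (trans (cong (_* y) (⁻¹-inverseˡ x≢0)) (*-identityˡ y))

  *-cancelˡ : ∀ {x y z} → x ≢ 0# → x * y ≡ x * z → y ≡ z
  *-cancelˡ {x} {y} {z} x≢0 xy≡xz =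
    trans (sym (⁻¹-cancelˡ y x≢0)) (trans (cong (x ⁻¹ *_) xy≡xz) (⁻¹-cancelˡ z x≢0))

  ⁻¹-cancelʳ : ∀ {x} y → x ≢ 0# → x * (x ⁻¹ * y) ≡ y
  ⁻¹-cancelʳ {x} y x≢0 =
    trans (sym (*-assoc _ _ _)) (trans (cong (_* y) (inverse x x≢0)) (*-identityˡ y))

  *≡0⇒ : ∀ {x y} → x * y ≡ 0# → x ≡ 0# ⊎ y ≡ 0#
  *≡0⇒ {x} {y} xy≡0 with x ≟ 0#
  ... | yes x≡0 = inj₁ x≡0
  ... | no x≢0  = inj₂ (*-cancelˡ x≢0 (trans xy≡0 (sym (zeroʳ x))))

  *-≢0 : ∀ {x y} → x ≢ 0# → y ≢ 0# → x * y ≢ 0#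
  *-≢0 x≢0 y≢0 xy≡0 with *≡0⇒ xy≡0
  ... | inj₁ x≡0 = x≢0 x≡0
  ... | inj₂ y≡0 = y≢0 y≡0

  1≢0 : 1# ≢ 0#
  1≢0 1≡0 = 0≢1 (sym 1≡0)

  ⁻¹-unique : ∀ {x y} → x * y ≡ 1# → x ⁻¹ ≡ y
  ⁻¹-unique {x} {y} xy≡1 = *-cancelˡ x≢0 (trans (inverse x x≢0) (sym xy≡1))
    where
    x≢0 : x ≢ 0#
    x≢0 x≡0 = 0≢1 (trans (sym (zeroˡ y)) (trans (cong (_* y) (sym x≡0)) xy≡1))

  ⁻¹-≢0 : ∀ {x} → x ≢ 0# → x ⁻¹ ≢ 0#
  ⁻¹-≢0 {x} x≢0 x⁻¹≡0 =
    0≢1 (trans (sym (zeroʳ x)) (trans (cong (x *_) (sym x⁻¹≡0)) (inverse x x≢0)))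

  -‿≢0 : ∀ {x} → x ≢ 0# → - x ≢ 0#
  -‿≢0 {x} x≢0 -x≡0 = x≢0 (trans (sym (-‿involutive x)) (trans (cong -_ -x≡0) -0#≈0#))

  ^-≢0 : ∀ {x} n → x ≢ 0# → x ^ n ≢ 0#
  ^-≢0 zero    x≢0 = 1≢0
  ^-≢0 (suc n) x≢0 = *-≢0 x≢0 (^-≢0 n x≢0)

  1^n≡1 : ∀ n → 1# ^ n ≡ 1#
  1^n≡1 zero    = refl
  1^n≡1 (suc n) = trans (*-identityˡ _) (1^n≡1 n)

  pow≡^ : ∀ x n → pow x n ≡ x ^ n
  pow≡^ x zero    = refl
  pow≡^ x (suc n) = cong (x *_) (pow≡^ x n)

  ×1-homo-^ : ∀ m n → (m ℕ.^ n) · 1# ≡ (m · 1#) ^ n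
  ×1-homo-^ m zero    = +-identityʳ 1#
  ×1-homo-^ m (suc n) = trans (×1-homo-* m (m ℕ.^ n)) (cong ((m · 1#) *_) (×1-homo-^ m n))

  -- Translation by 1# permutes the elements, so their sum S satisfies S + n · 1# ≡ S.
  card·1≡0 : ∀ {n} → length elems ≡ n → n · 1# ≡ 0#
  card·1≡0 {n} |K|≡n = begin
    n · 1#              ≡⟨ solve 2 (λ S N → N := (S :+ N) :- S) refl S (n · 1#) ⟩
    (S + n · 1#) - S    ≡⟨ cong (_- S) S+n·1≡S ⟩
    S - S               ≡⟨ -‿inverseʳ S ⟩
    0#                  ∎
    where
    open ≡-Reasoning
    sum : List Carrier → Carrier
    sum = foldr _+_ 0#
    S = sum elems
    sum-map-+1 : ∀ zs → sum (map (_+ 1#) zs) ≡ sum zs + length zs · 1#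
    sum-map-+1 [] = sym (+-identityʳ 0#)
    sum-map-+1 (z ∷ zs) = trans (cong ((z + 1#) +_) (sum-map-+1 zs))
      (solve 3 (λ z S N → (z :+ :1) :+ (S :+ N) := (z :+ S) :+ (:1 :+ N)) refl z (sum zs) (length zs · 1#))
    +1-injective : ∀ {y z} → y + 1# ≡ z + 1# → y ≡ z
    +1-injective {y} {z} y+1≡z+1 = begin
      y                 ≡⟨ solve 1 (λ y → y := (y :+ :1) :- :1) refl y ⟩
      (y + 1#) - 1#     ≡⟨ cong (_- 1#) y+1≡z+1 ⟩
      (z + 1#) - 1#     ≡⟨ solve 1 (λ z → (z :+ :1) :- :1 := z) refl z ⟩
      z                 ∎
    +1-surjective : ∀ z → z ∈ map (_+ 1#) elems
    +1-surjective z = subst (_∈ map (_+ 1#) elems) (solve 1 (λ z → (z :- :1) :+ :1 := z) refl z)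
      (∈-map⁺ (_+ 1#) (complete (z - 1#)))
    +1-↭ : map (_+ 1#) elems ↭ elems
    +1-↭ = ∼bag⇒↭ (unique∧set⇒bag (Unique.map⁺ +1-injective unique) unique
      (λ {z} → mk⇔ (λ _ → complete z) (λ _ → +1-surjective z)))
    S+n·1≡S : S + n · 1# ≡ S
    S+n·1≡S = begin
      S + n · 1#                 ≡⟨ cong (λ m → S + m · 1#) (sym |K|≡n) ⟩
      S + length elems · 1#      ≡⟨ sym (sum-map-+1 elems) ⟩
      sum (map (_+ 1#) elems)    ≡⟨ foldr-commMonoid (≡.setoid Carrier) +-isCommutativeMonoid (↭⇒↭ₛ +1-↭) ⟩
      S                          ∎

  characteristic : ∀ {p k} → Prime p → length elems ≡ p ℕ.^ k ℕ.* p ℕ.^ k → p · 1# ≡ 0#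
  characteristic {p} {k} p-prime |K|≡pᵏpᵏ with (p · 1#) ≟ 0#
  ... | yes p·1≡0 = p·1≡0
  ... | no p·1≢0 = contradiction (begin
    (p · 1#) ^ k * (p · 1#) ^ k               ≡⟨ sym (cong₂ _*_ (×1-homo-^ p k) (×1-homo-^ p k)) ⟩
    ((p ℕ.^ k) · 1#) * ((p ℕ.^ k) · 1#)      ≡⟨ sym (×1-homo-* (p ℕ.^ k) (p ℕ.^ k)) ⟩
    (p ℕ.^ k ℕ.* p ℕ.^ k) · 1#               ≡⟨ card·1≡0 |K|≡pᵏpᵏ ⟩
    0#                                       ∎) (*-≢0 (^-≢0 k p·1≢0) (^-≢0 k p·1≢0))
    where open ≡-Reasoning

-- The subfield F_r and the group AGL(1, r)

module FixedField (K : FiniteField) {p n r : ℕ} (p-prime : Prime p) (1≤n : 1 ℕ.≤ n) (r≡pⁿ : r ≡ p ℕ.^ n)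
                  (card : length (FiniteField.elems K) ≡ r ℕ.* r) where
  open FF K
  open Sub r
  open FieldProperties K
  open Frobenius commutativeSemiring using (frobenius-^)
  open import Algebra.Properties.CommutativeSemiring.Exp commutativeSemiring using (^-distrib-*)
  open ≡-Reasoning

  r≡2+r∸2 : r ≡ 2 ℕ.+ (r ℕ.∸ 2)
  r≡2+r∸2 = sym (m+[n∸m]≡n (subst (1 ℕ.<_) (sym r≡pⁿ) (^-monoʳ-< p 1<p 1≤n)))
    where 1<p = nonTrivial⇒n>1 p {{prime⇒nonTrivial p-prime}}

  ^r-+ : ∀ x y → (x + y) ^ r ≡ x ^ r + y ^ r
  ^r-+ x y = subst (λ m → (x + y) ^ m ≡ x ^ m + y ^ m) (sym r≡pⁿ) (frobenius-^ p-prime p·1≡0 n x y)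
    where
    p·1≡0 : p · 1# ≡ 0#
    p·1≡0 = characteristic {k = n} p-prime (subst (λ m → length elems ≡ m ℕ.* m) r≡pⁿ card)

  InFr⇒^r : ∀ {x} → InFr x → x ^ r ≡ x
  InFr⇒^r {x} = trans (sym (pow≡^ x r))

  ^r⇒InFr : ∀ {x} → x ^ r ≡ x → InFr x
  ^r⇒InFr {x} = trans (pow≡^ x r)

  InFr? : ∀ z → Dec (InFr z)
  InFr? z = pow z r ≟ z

  InFr-0 : InFr 0#
  InFr-0 = ^r⇒InFr (trans (cong (0# ^_) r≡2+r∸2) (zeroˡ _))

  InFr-1 : InFr 1#
  InFr-1 = ^r⇒InFr (1^n≡1 r)

  InFr-+ : ∀ {x y} → InFr x → InFr y → InFr (x + y)
  InFr-+ {x} {y} x∈F y∈F = ^r⇒InFr (trans (^r-+ x y) (cong₂ _+_ (InFr⇒^r x∈F) (InFr⇒^r y∈F)))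

  InFr-* : ∀ {x y} → InFr x → InFr y → InFr (x * y)
  InFr-* {x} {y} x∈F y∈F = ^r⇒InFr (trans (^-distrib-* x y r) (cong₂ _*_ (InFr⇒^r x∈F) (InFr⇒^r y∈F)))

  -1^r≡-1 : (- 1#) ^ r ≡ - 1#
  -1^r≡-1 = begin
    (- 1#) ^ r                    ≡⟨ solve 1 (λ t → t := (:1 :+ t) :- :1) refl _ ⟩
    (1# + (- 1#) ^ r) - 1#        ≡⟨ cong (λ t → (t + (- 1#) ^ r) - 1#) (sym (1^n≡1 r)) ⟩
    (1# ^ r + (- 1#) ^ r) - 1#    ≡⟨ cong (_- 1#) (sym (^r-+ 1# (- 1#))) ⟩
    (1# - 1#) ^ r - 1#            ≡⟨ cong (λ t → t ^ r - 1#) (-‿inverseʳ 1#) ⟩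
    0# ^ r - 1#                   ≡⟨ cong (_- 1#) (InFr⇒^r InFr-0) ⟩
    0# - 1#                       ≡⟨ +-identityˡ _ ⟩
    - 1#                          ∎

  InFr-‿ : ∀ {x} → InFr x → InFr (- x)
  InFr-‿ {x} x∈F = ^r⇒InFr (begin
    (- x) ^ r             ≡⟨ cong (_^ r) (solve 1 (λ x → :- x := (:- :1) :* x) refl x) ⟩
    (- 1# * x) ^ r        ≡⟨ ^-distrib-* (- 1#) x r ⟩
    (- 1#) ^ r * x ^ r    ≡⟨ cong₂ _*_ -1^r≡-1 (InFr⇒^r x∈F) ⟩
    - 1# * x              ≡⟨ solve 1 (λ x → (:- :1) :* x := :- x) refl x ⟩
    - x                   ∎)

  InFr-difference : ∀ {x y} → InFr x → InFr y → InFr (x - y)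
  InFr-difference x∈F y∈F = InFr-+ x∈F (InFr-‿ y∈F)

  InFr-⁻¹ : ∀ {x} → InFr x → x ≢ 0# → InFr (x ⁻¹)
  InFr-⁻¹ {x} x∈F x≢0 = ^r⇒InFr (sym (⁻¹-unique (begin
    x * (x ⁻¹) ^ r        ≡⟨ cong (_* (x ⁻¹) ^ r) (sym (InFr⇒^r x∈F)) ⟩
    x ^ r * (x ⁻¹) ^ r    ≡⟨ sym (^-distrib-* x (x ⁻¹) r) ⟩
    (x * x ⁻¹) ^ r        ≡⟨ cong (_^ r) (inverse x x≢0) ⟩
    1# ^ r                ≡⟨ 1^n≡1 r ⟩
    1#                    ∎)))

  ⁻¹≡^[r∸2] : ∀ {x} → InFr x → x ≢ 0# → x ⁻¹ ≡ x ^ (r ℕ.∸ 2)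
  ⁻¹≡^[r∸2] {x} x∈F x≢0 = ⁻¹-unique (*-cancelˡ x≢0 (begin
    x * (x * x ^ (r ℕ.∸ 2))   ≡⟨ cong (x ^_) (sym r≡2+r∸2) ⟩
    x ^ r                     ≡⟨ InFr⇒^r x∈F ⟩
    x                         ≡⟨ sym (*-identityʳ x) ⟩
    x * 1#                    ∎))

  IsAGL? : ∀ g → Dec (IsAGL g)
  IsAGL? (c , d) = InFr? c ×-dec InFr? d ×-dec ¬? (c ≟ 0#)

  IsAGL-idMap : IsAGL idMap
  IsAGL-idMap = InFr-1 , InFr-0 , 1≢0

  IsAGL-compose : ∀ {g h} → IsAGL g → IsAGL h → IsAGL (compose g h)
  IsAGL-compose (c∈F , d∈F , c≢0) (c′∈F , d′∈F , c′≢0) =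
    InFr-* c∈F c′∈F , InFr-+ (InFr-* c∈F d′∈F) d∈F , *-≢0 c≢0 c′≢0

  IsAGL-invMap : ∀ {g} → IsAGL g → IsAGL (invMap g)
  IsAGL-invMap (c∈F , d∈F , c≢0) =
    InFr-⁻¹ c∈F c≢0 , InFr-‿ (InFr-* (InFr-⁻¹ c∈F c≢0) d∈F) , ⁻¹-≢0 c≢0

  apply-idMap : ∀ z → apply idMap z ≡ z
  apply-idMap = solve 1 (λ z → :1 :* z :+ :0 := z) refl

  apply-compose : ∀ g h z → apply (compose g h) z ≡ apply g (apply h z)
  apply-compose (c , d) (c′ , d′) =
    solve 5 (λ c d c′ d′ z → (c :* c′) :* z :+ (c :* d′ :+ d) := c :* (c′ :* z :+ d′) :+ d) refl c d c′ d′

  apply-invMapʳ : ∀ {c} d → c ≢ 0# → ∀ z → apply (c , d) (apply (invMap (c , d)) z) ≡ z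
  apply-invMapʳ {c} d c≢0 z = begin
    c * (c ⁻¹ * z + - (c ⁻¹ * d)) + d
      ≡⟨ cong (_+ d) (solve 4 (λ c c′ w d → c :* (c′ :* w :- c′ :* d) := c :* (c′ :* (w :- d)))
                              refl c (c ⁻¹) z d) ⟩
    c * (c ⁻¹ * (z - d)) + d
      ≡⟨ cong (_+ d) (⁻¹-cancelʳ (z - d) c≢0) ⟩
    (z - d) + d
      ≡⟨ solve 2 (λ z d → (z :- d) :+ d := z) refl z d ⟩
    z ∎

  apply-invMapˡ : ∀ {c} d → c ≢ 0# → ∀ z → apply (invMap (c , d)) (apply (c , d) z) ≡ z
  apply-invMapˡ {c} d c≢0 z = begin
    c ⁻¹ * (c * z + d) + - (c ⁻¹ * d)
      ≡⟨ solve 4 (λ c c′ z d → c′ :* (c :* z :+ d) :- c′ :* d := c′ :* (c :* z)) refl c (c ⁻¹) z d ⟩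
    c ⁻¹ * (c * z)
      ≡⟨ ⁻¹-cancelˡ z c≢0 ⟩
    z ∎

  apply-InFr : ∀ {g z} → IsAGL g → InFr z → InFr (apply g z)
  apply-InFr (c∈F , d∈F , _) z∈F = InFr-+ (InFr-* c∈F z∈F) d∈F

  apply-injective : ∀ {g} → IsAGL g → ∀ {u v} → apply g u ≡ apply g v → u ≡ v
  apply-injective {c , d} (_ , _ , c≢0) {u} {v} gu≡gv = begin
    u                                          ≡⟨ sym (apply-invMapˡ d c≢0 u) ⟩
    apply (invMap (c , d)) (apply (c , d) u)   ≡⟨ cong (apply (invMap (c , d))) gu≡gv ⟩
    apply (invMap (c , d)) (apply (c , d) v)   ≡⟨ apply-invMapˡ d c≢0 v ⟩
    v                                          ∎

  1-c≢0 : ∀ {c} → c ≢ 1# → 1# - c ≢ 0#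
  1-c≢0 c≢1 1-c≡0 = c≢1 (sym (x∙y⁻¹≈ε⇒x≈y _ _ 1-c≡0))

  centre : Pair → Carrier
  centre (c , d) = d * (1# - c) ⁻¹

  apply-centre : ∀ c d → c ≢ 1# → apply (c , d) (centre (c , d)) ≡ centre (c , d)
  apply-centre c d c≢1 = begin
    c * (d * i) + d
      ≡⟨ cong (c * (d * i) +_) (sym (trans (cong (d *_) (inverse (1# - c) (1-c≢0 c≢1))) (*-identityʳ d))) ⟩
    c * (d * i) + d * ((1# - c) * i)
      ≡⟨ solve 3 (λ c d i → c :* (d :* i) :+ d :* ((:1 :- c) :* i) := d :* i) refl c d i ⟩
    d * i ∎
    where i = (1# - c) ⁻¹

  centre-InFr : ∀ {g} → IsAGL g → proj₁ g ≢ 1# → InFr (centre g)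
  centre-InFr (c∈F , d∈F , _) c≢1 = InFr-* d∈F (InFr-⁻¹ (InFr-difference InFr-1 c∈F) (1-c≢0 c≢1))

  fixing-slope-1⇒idMap : ∀ {c d} a → c ≡ 1# → apply (c , d) a ≡ a → (c , d) ≡ idMap
  fixing-slope-1⇒idMap {d = d} a refl fixes = cong (1# ,_) (begin
    d                   ≡⟨ solve 2 (λ a d → d := (:1 :* a :+ d) :- a) refl a d ⟩
    (1# * a + d) - a    ≡⟨ cong (_- a) fixes ⟩
    a - a               ≡⟨ -‿inverseʳ a ⟩
    0#                  ∎)

  fixed-point-translation : ∀ {c d a} → apply (c , d) a ≡ a → d ≡ a - c * a
  fixed-point-translation {c} {d} {a} fixes =
    trans (solve 3 (λ c d a → d := (c :* a :+ d) :- c :* a) refl c d a) (cong (_- c * a) fixes)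

  commutator-of-homotheties : ∀ {c₁ d₁ c₂ d₂ a₁ a₂} →
    apply (c₁ , d₁) a₁ ≡ a₁ → apply (c₂ , d₂) a₂ ≡ a₂ →
    ∀ w → apply (c₁ , d₁) (apply (c₂ , d₂) w) ≡
          apply (c₂ , d₂) (apply (c₁ , d₁) w) + (1# - c₁) * ((1# - c₂) * (a₁ - a₂))
  commutator-of-homotheties {c₁} {d₁} {c₂} {d₂} {a₁} {a₂} fixes₁ fixes₂ w
    rewrite fixed-point-translation fixes₁ | fixed-point-translation fixes₂ =
    solve 5 (λ c₁ c₂ a₁ a₂ w →
      c₁ :* (c₂ :* w :+ (a₂ :- c₂ :* a₂)) :+ (a₁ :- c₁ :* a₁)
        := (c₂ :* (c₁ :* w :+ (a₁ :- c₁ :* a₁)) :+ (a₂ :- c₂ :* a₂))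
           :+ (:1 :- c₁) :* ((:1 :- c₂) :* (a₁ :- a₂))) refl c₁ c₂ a₁ a₂ w

  -- Admissible affine maps

  module Admissibility (A : Carrier → Bool) where

    Stabilises : Pair → Set
    Stabilises g = ∀ z → InFr z → A (apply g z) ≡ A z

    FixedPointsInA : Pair → Set
    FixedPointsInA g = g ≢ idMap → ∀ a → InFr a → apply g a ≡ a → A a ≡ true

    Admissible : Pair → Set
    Admissible g = IsAGL g × Stabilises g × FixedPointsInA g

    IsPeriod : Carrier → Set
    IsPeriod v = InFr v × (∀ z → InFr z → A (z + v) ≡ A z)

    Stabilises-compose : ∀ g h → IsAGL h → Stabilises g → Stabilises h → Stabilises (compose g h)
    Stabilises-compose g h h∈AGL g-stab h-stab z z∈F =
      trans (cong A (apply-compose g h z)) (trans (g-stab _ (apply-InFr h∈AGL z∈F)) (h-stab z z∈F))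

    Stabilises-invMap : ∀ g → IsAGL g → Stabilises g → Stabilises (invMap g)
    Stabilises-invMap g@(c , d) g∈AGL@(_ , _ , c≢0) g-stab z z∈F =
      trans (sym (g-stab _ (apply-InFr (IsAGL-invMap g∈AGL) z∈F))) (cong A (apply-invMapʳ d c≢0 z))

    PropertyI⇒Admissible : ∀ {G} → IsSubgroupAGL G → PropertyI G A → ∀ {g} → G g ≡ true → Admissible g
    PropertyI⇒Admissible {G} (G⊆AGL , _ , _ , G-invMap) (G-preserves , G-fixed) {g@(c , d)} g∈G =
      g∈AGL , g-stab , G-fixed g g∈G
      where
      g∈AGL = G⊆AGL g g∈G
      g⁻¹-preserves : ∀ z → A (apply g z) ≡ true → A z ≡ true
      g⁻¹-preserves z gz∈A = subst (λ w → A w ≡ true) (apply-invMapˡ d (proj₂ (proj₂ g∈AGL)) z)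
        (G-preserves (invMap g) (G-invMap g g∈G) _ gz∈A)
      g-stab : Stabilises g
      g-stab z _ = bool-ext (g⁻¹-preserves z) (G-preserves g g∈G z)

    IsPeriod-+ : ∀ {u v} → IsPeriod u → IsPeriod v → IsPeriod (u + v)
    IsPeriod-+ {u} {v} (u∈F , u-period) (v∈F , v-period) = InFr-+ u∈F v∈F , λ z z∈F →
      trans (cong A (sym (+-assoc z u v))) (trans (v-period (z + u) (InFr-+ z∈F u∈F)) (u-period z z∈F))

    IsPeriod-‿ : ∀ {v} → IsPeriod v → IsPeriod (- v)
    IsPeriod-‿ {v} (v∈F , v-period) = InFr-‿ v∈F , λ z z∈F →
      trans (sym (v-period (z - v) (InFr-difference z∈F v∈F))) (cong A (solve 2 (λ z v → (z :- v) :+ v := z) refl z v))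

    IsPeriod-slope : ∀ {g} → IsAGL g → Stabilises g → ∀ {v} → IsPeriod v → IsPeriod (proj₁ g * v)
    IsPeriod-slope {c , d} g∈AGL@(c∈F , _ , c≢0) g-stab {v} (v∈F , v-period) = InFr-* c∈F v∈F , c*v-period
      where
      c*v-period : ∀ z → InFr z → A (z + c * v) ≡ A z
      c*v-period z z∈F = begin
        A (z + c * v)                 ≡⟨ cong (λ u → A (u + c * v)) (sym gw≡z) ⟩
        A (apply (c , d) w + c * v)   ≡⟨ cong A (solve 4 (λ c d w v → (c :* w :+ d) :+ c :* v
                                                            := c :* (w :+ v) :+ d) refl c d w v) ⟩
        A (apply (c , d) (w + v))     ≡⟨ g-stab (w + v) (InFr-+ w∈F v∈F) ⟩
        A (w + v)                     ≡⟨ v-period w w∈F ⟩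
        A w                           ≡⟨ sym (g-stab w w∈F) ⟩
        A (apply (c , d) w)           ≡⟨ cong A gw≡z ⟩
        A z                           ∎
        where
        w = apply (invMap (c , d)) z
        w∈F = apply-InFr (IsAGL-invMap g∈AGL) z∈F
        gw≡z = apply-invMapʳ d c≢0 z

    IsPeriod-1-slope : ∀ {g} → IsAGL g → Stabilises g → ∀ {v} → IsPeriod v → IsPeriod ((1# - proj₁ g) * v)
    IsPeriod-1-slope {c , d} g∈AGL g-stab {v} v-period =
      subst IsPeriod (solve 2 (λ c v → v :- c :* v := (:1 :- c) :* v) refl c v)
        (IsPeriod-+ v-period (IsPeriod-‿ (IsPeriod-slope g∈AGL g-stab v-period)))

    IsPeriod-^ : ∀ {e} → (∀ {v} → IsPeriod v → IsPeriod (e * v)) →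
                 ∀ n {v} → IsPeriod v → IsPeriod (e ^ n * v)
    IsPeriod-^ e-period zero    {v} v-period = subst IsPeriod (sym (*-identityˡ v)) v-period
    IsPeriod-^ {e} e-period (suc n) {v} v-period =
      subst IsPeriod (sym (*-assoc e (e ^ n) v)) (e-period (IsPeriod-^ e-period n v-period))

    IsPeriod-[1-slope]⁻¹ : ∀ {g} → IsAGL g → Stabilises g → proj₁ g ≢ 1# →
                           ∀ {v} → IsPeriod v → IsPeriod ((1# - proj₁ g) ⁻¹ * v)
    IsPeriod-[1-slope]⁻¹ {c , d} g∈AGL@(c∈F , _) g-stab c≢1 {v} v-period =
      subst (λ e → IsPeriod (e * v)) (sym (⁻¹≡^[r∸2] (InFr-difference InFr-1 c∈F) (1-c≢0 c≢1)))
        (IsPeriod-^ (IsPeriod-1-slope g∈AGL g-stab) (r ℕ.∸ 2) v-period)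

    -- The commutator of the two homotheties is the translation by t = (1 - c₁)(1 - c₂)(a₁ - a₂),
    -- a period of A; dividing t by 1 - c₁ and 1 - c₂ keeps it a period.
    centres-difference-IsPeriod : ∀ {g₁ g₂ a₁ a₂} →
      IsAGL g₁ → Stabilises g₁ → proj₁ g₁ ≢ 1# → InFr a₁ → apply g₁ a₁ ≡ a₁ →
      IsAGL g₂ → Stabilises g₂ → proj₁ g₂ ≢ 1# → InFr a₂ → apply g₂ a₂ ≡ a₂ → IsPeriod (a₁ - a₂)
    centres-difference-IsPeriod {g₁@(c₁ , d₁)} {g₂@(c₂ , d₂)} {a₁} {a₂}
        g₁∈AGL@(c₁∈F , _) g₁-stab c₁≢1 a₁∈F fixes₁
        g₂∈AGL@(c₂∈F , _) g₂-stab c₂≢1 a₂∈F fixes₂ =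
      subst IsPeriod (⁻¹-cancelˡ (a₁ - a₂) (1-c≢0 c₂≢1))
        (IsPeriod-[1-slope]⁻¹ g₂∈AGL g₂-stab c₂≢1
          (subst IsPeriod (⁻¹-cancelˡ ((1# - c₂) * (a₁ - a₂)) (1-c≢0 c₁≢1))
            (IsPeriod-[1-slope]⁻¹ g₁∈AGL g₁-stab c₁≢1 (t∈F , t-period))))
      where
      t = (1# - c₁) * ((1# - c₂) * (a₁ - a₂))
      t∈F = InFr-* (InFr-difference InFr-1 c₁∈F)
                   (InFr-* (InFr-difference InFr-1 c₂∈F) (InFr-difference a₁∈F a₂∈F))
      t-period : ∀ z → InFr z → A (z + t) ≡ A z
      t-period z z∈F = begin
        A (z + t)                         ≡⟨ cong (λ u → A (u + t)) (sym g₂g₁w≡z) ⟩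
        A (apply g₂ (apply g₁ w) + t)     ≡⟨ cong A (sym (commutator-of-homotheties fixes₁ fixes₂ w)) ⟩
        A (apply g₁ (apply g₂ w))         ≡⟨ g₁-stab _ (apply-InFr g₂∈AGL w∈F) ⟩
        A (apply g₂ w)                    ≡⟨ g₂-stab w w∈F ⟩
        A w                               ≡⟨ sym (g₁-stab w w∈F) ⟩
        A (apply g₁ w)                    ≡⟨ sym (g₂-stab _ (apply-InFr g₁∈AGL w∈F)) ⟩
        A (apply g₂ (apply g₁ w))         ≡⟨ cong A g₂g₁w≡z ⟩
        A z                               ∎
        where
        h = compose g₂ g₁
        h∈AGL = IsAGL-compose g₂∈AGL g₁∈AGL
        w = apply (invMap h) z
        w∈F = apply-InFr (IsAGL-invMap h∈AGL) z∈F
        g₂g₁w≡z : apply g₂ (apply g₁ w) ≡ z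
        g₂g₁w≡z = trans (sym (apply-compose g₂ g₁ w)) (apply-invMapʳ (proj₂ h) (proj₂ (proj₂ h∈AGL)) z)

    -- b differs from the centre of k, which lies in A, by a period of A.
    fixed-point∈A : ∀ {h k b} → IsAGL h → Stabilises h → proj₁ h ≢ 1# → InFr b → apply h b ≡ b →
      Admissible k → proj₁ k ≢ 1# → A b ≡ true
    fixed-point∈A {h} {k@(c , d)} {b} h∈AGL h-stab h-slope≢1 b∈F fixes-b (k∈AGL , k-stab , k-fixed) k-slope≢1 =
      begin
        A b                ≡⟨ cong A (solve 2 (λ b a → b := a :+ (b :- a)) refl b a) ⟩
        A (a + (b - a))    ≡⟨ proj₂ b-a-period a a∈F ⟩
        A a                ≡⟨ k-fixed (λ k≡id → k-slope≢1 (cong proj₁ k≡id)) a a∈F fixes-a ⟩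
        true               ∎
      where
      a = centre k
      a∈F = centre-InFr k∈AGL k-slope≢1
      fixes-a = apply-centre c d k-slope≢1
      b-a-period = centres-difference-IsPeriod h∈AGL h-stab h-slope≢1 b∈F fixes-b k∈AGL k-stab k-slope≢1 a∈F fixes-a

    Admissible-idMap : Admissible idMap
    Admissible-idMap = IsAGL-idMap , (λ z _ → cong A (apply-idMap z)) , (λ id≢id → ⊥-elim (id≢id refl))

    Admissible-invMap : ∀ {g} → Admissible g → Admissible (invMap g)
    Admissible-invMap {g@(c , d)} (g∈AGL@(_ , _ , c≢0) , g-stab , g-fixed) =
      IsAGL-invMap g∈AGL , Stabilises-invMap g g∈AGL g-stab , fixed
      where
      fixed : FixedPointsInA (invMap g)
      fixed g⁻¹≢id a a∈F fixes =
        g-fixed g≢id a a∈F (trans (cong (apply g) (sym fixes)) (apply-invMapʳ d c≢0 a))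
        where
        g≢id : g ≢ idMap
        g≢id refl = g⁻¹≢id (cong₂ _,_ (⁻¹-unique (*-identityˡ 1#)) (trans (cong -_ (zeroʳ _)) -0#≈0#))

    -- A translation with a fixed point is the identity, so g h ≢ id fixing b is a homothety,
    -- and so is one of g and h.
    Admissible-compose : ∀ {g h} → Admissible g → Admissible h → Admissible (compose g h)
    Admissible-compose {g@(c , d)} {h@(c′ , d′)} g-adm@(g∈AGL , g-stab , _) h-adm@(h∈AGL , h-stab , _) =
      gh∈AGL , gh-stab , fixed
      where
      gh∈AGL = IsAGL-compose g∈AGL h∈AGL
      gh-stab = Stabilises-compose g h h∈AGL g-stab h-stab
      fixed : FixedPointsInA (compose g h)
      fixed gh≢id b b∈F fixes with (c * c′) ≟ 1#
      ... | yes cc′≡1 = ⊥-elim (gh≢id (fixing-slope-1⇒idMap b cc′≡1 fixes))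
      ... | no cc′≢1 with c ≟ 1#
      ...   | no c≢1  = fixed-point∈A gh∈AGL gh-stab cc′≢1 b∈F fixes g-adm c≢1
      ...   | yes c≡1 = fixed-point∈A gh∈AGL gh-stab cc′≢1 b∈F fixes h-adm c′≢1
        where
        c′≢1 : c′ ≢ 1#
        c′≢1 c′≡1 = cc′≢1 (trans (cong₂ _*_ c≡1 c′≡1) (*-identityˡ 1#))

    -- The clique through x

    module PointOutsideFr (A⊆F : ∀ a → A a ≡ true → InFr a) (x : Carrier) (x∉F : ¬ InFr x) where
      open Net A x

      independent-over-F : ∀ {c d c′ d′} → InFr c → InFr d → InFr c′ → InFr d′ →
        c * x + d ≡ c′ * x + d′ → c ≡ c′ × d ≡ d′
      independent-over-F {c} {d} {c′} {d′} c∈F d∈F c′∈F d′∈F cx+d≡c′x+d′ with c ≟ c′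
      ... | yes refl = refl , (begin
        d                      ≡⟨ solve 3 (λ c x d → d := (c :* x :+ d) :- c :* x) refl c x d ⟩
        (c * x + d) - c * x    ≡⟨ cong (_- c * x) cx+d≡c′x+d′ ⟩
        (c * x + d′) - c * x   ≡⟨ solve 3 (λ c x d → (c :* x :+ d) :- c :* x := d) refl c x d′ ⟩
        d′                     ∎)
      ... | no c≢c′ = ⊥-elim (x∉F (subst InFr x≡ u⁻¹[d′-d]∈F))
        where
        u = c - c′
        u≢0 : u ≢ 0#
        u≢0 u≡0 = c≢c′ (x∙y⁻¹≈ε⇒x≈y _ _ u≡0)
        ux≡d′-d : u * x ≡ d′ - d
        ux≡d′-d = begin
          (c - c′) * x
            ≡⟨ solve 4 (λ c c′ x d → (c :- c′) :* x := (c :* x :+ d) :- (c′ :* x :+ d)) refl c c′ x d ⟩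
          (c * x + d) - (c′ * x + d)
            ≡⟨ cong (_- (c′ * x + d)) cx+d≡c′x+d′ ⟩
          (c′ * x + d′) - (c′ * x + d)
            ≡⟨ solve 4 (λ c′ x d′ d → (c′ :* x :+ d′) :- (c′ :* x :+ d) := d′ :- d) refl c′ x d′ d ⟩
          d′ - d ∎
        x≡ : u ⁻¹ * (d′ - d) ≡ x
        x≡ = trans (cong (u ⁻¹ *_) (sym ux≡d′-d)) (⁻¹-cancelˡ x u≢0)
        u⁻¹[d′-d]∈F = InFr-* (InFr-⁻¹ (InFr-difference c∈F c′∈F) u≢0) (InFr-difference d′∈F d∈F)

      apply-x-injective : ∀ {g h} → IsAGL g → IsAGL h → apply g x ≡ apply h x → g ≡ h
      apply-x-injective (c∈F , d∈F , _) (c′∈F , d′∈F , _) gx≡hx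
        with independent-over-F c∈F d∈F c′∈F d′∈F gx≡hx
      ... | refl , refl = refl

      apply-x∉F : ∀ {g} → IsAGL g → ¬ InFr (apply g x)
      apply-x∉F {c , d} (c∈F , d∈F , c≢0) gx∈F =
        x∉F (subst InFr x≡ (InFr-* (InFr-⁻¹ c∈F c≢0) (InFr-difference gx∈F d∈F)))
        where
        x≡ : c ⁻¹ * ((c * x + d) - d) ≡ x
        x≡ = trans (cong (c ⁻¹ *_) (solve 3 (λ c x d → (c :* x :+ d) :- d := c :* x) refl c x d))
                   (⁻¹-cancelˡ x c≢0)

      Adj-InFr : ∀ {u v} → u ≢ v → InFr (u - v) → Adj u v
      Adj-InFr u≢v u-v∈F = u≢v , (λ u-v≡0 → u≢v (x∙y⁻¹≈ε⇒x≈y _ _ u-v≡0)) , inj₁ u-v∈F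

      Adj-line : ∀ {u v a t} → u ≢ v → A a ≡ true → InFr t → t ≢ 0# → u - v ≡ t * (x - a) → Adj u v
      Adj-line {a = a} {t} u≢v a∈A t∈F t≢0 u-v≡ =
        u≢v , (λ u-v≡0 → u≢v (x∙y⁻¹≈ε⇒x≈y _ _ u-v≡0)) , inj₂ (a , a∈A , t , t∈F , t≢0 , u-v≡)

      Adj-sym : ∀ {u v} → Adj u v → Adj v u
      Adj-sym {u} {v} (u≢v , _ , inj₁ u-v∈F) =
        Adj-InFr (≢-sym u≢v) (subst InFr (sym (v-u≡ u v)) (InFr-‿ u-v∈F))
        where v-u≡ = solve 2 (λ u v → v :- u := :- (u :- v)) refl
      Adj-sym {u} {v} (u≢v , _ , inj₂ (a , a∈A , t , t∈F , t≢0 , u-v≡)) =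
        Adj-line (≢-sym u≢v) a∈A (InFr-‿ t∈F) (-‿≢0 t≢0) (begin
          v - u              ≡⟨ solve 2 (λ u v → v :- u := :- (u :- v)) refl u v ⟩
          - (u - v)          ≡⟨ cong -_ u-v≡ ⟩
          - (t * (x - a))    ≡⟨ solve 3 (λ t x a → :- (t :* (x :- a)) := (:- t) :* (x :- a)) refl t x a ⟩
          - t * (x - a)      ∎)

      Adj-image-A : ∀ {k a} → Admissible k → A a ≡ true → Adj (apply k x) a
      Adj-image-A {k@(c , d)} {a} (k∈AGL@(c∈F , _ , c≢0) , k-stab , _) a∈A = Adj-line kx≢a b∈A c∈F c≢0 kx-a≡
        where
        a∈F = A⊆F a a∈A
        kx≢a : apply k x ≢ a
        kx≢a kx≡a = apply-x∉F k∈AGL (subst InFr (sym kx≡a) a∈F)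
        b = apply (invMap k) a
        b∈A : A b ≡ true
        b∈A = trans (sym (k-stab b (apply-InFr (IsAGL-invMap k∈AGL) a∈F)))
                    (trans (cong A (apply-invMapʳ d c≢0 a)) a∈A)
        kx-a≡ : (c * x + d) - a ≡ c * (x - b)
        kx-a≡ = begin
          (c * x + d) - a
            ≡⟨ cong (λ z → (c * x + d) - z) (sym (apply-invMapʳ d c≢0 a)) ⟩
          (c * x + d) - (c * b + d)
            ≡⟨ solve 4 (λ c x d b → (c :* x :+ d) :- (c :* b :+ d) := c :* (x :- b)) refl c x d b ⟩
          c * (x - b) ∎

      Adj-x-A : ∀ {a} → A a ≡ true → Adj x a
      Adj-x-A a∈A = subst (λ z → Adj z _) (apply-idMap x) (Adj-image-A Admissible-idMap a∈A)

      -- For slopes c ≢ c′, the point a = (c - c′)⁻¹ (d′ - d) is fixed by the admissible map j⁻¹ k,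
      -- so a ∈ A, and k x - j x = (c - c′) (x - a).
      Adj-images : ∀ {k j} → Admissible k → Admissible j → apply k x ≢ apply j x → Adj (apply k x) (apply j x)
      Adj-images {k@(c , d)} {j@(c′ , d′)}
                 k-adm@((c∈F , d∈F , _) , _) j-adm@((c′∈F , d′∈F , c′≢0) , _) kx≢jx with c ≟ c′
      ... | yes refl = Adj-InFr kx≢jx (subst InFr d-d′≡ (InFr-difference d∈F d′∈F))
        where d-d′≡ = solve 4 (λ c x d d′ → d :- d′ := (c :* x :+ d) :- (c :* x :+ d′)) refl c x d d′
      ... | no c≢c′ = Adj-line kx≢jx a∈A (InFr-difference c∈F c′∈F) u≢0 kx-jx≡
        where
        u = c - c′
        u≢0 : u ≢ 0#
        u≢0 u≡0 = c≢c′ (x∙y⁻¹≈ε⇒x≈y _ _ u≡0)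
        a = u ⁻¹ * (d′ - d)
        a∈F = InFr-* (InFr-⁻¹ (InFr-difference c∈F c′∈F) u≢0) (InFr-difference d′∈F d∈F)
        ua≡d′-d : u * a ≡ d′ - d
        ua≡d′-d = ⁻¹-cancelʳ (d′ - d) u≢0
        ka≡ja : apply k a ≡ apply j a
        ka≡ja = begin
          c * a + d
            ≡⟨ solve 5 (λ c c′ a d d′ → c :* a :+ d := (c′ :* a :+ d′) :+ ((c :- c′) :* a :- (d′ :- d)))
                 refl c c′ a d d′ ⟩
          (c′ * a + d′) + (u * a - (d′ - d))
            ≡⟨ cong (λ w → (c′ * a + d′) + (w - (d′ - d))) ua≡d′-d ⟩
          (c′ * a + d′) + ((d′ - d) - (d′ - d))
            ≡⟨ cong ((c′ * a + d′) +_) (-‿inverseʳ (d′ - d)) ⟩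
          (c′ * a + d′) + 0#
            ≡⟨ +-identityʳ _ ⟩
          c′ * a + d′ ∎
        g = compose (invMap j) k
        g-fixes-a : apply g a ≡ a
        g-fixes-a = trans (apply-compose (invMap j) k a)
                          (trans (cong (apply (invMap j)) ka≡ja) (apply-invMapˡ d′ c′≢0 a))
        g≢id : g ≢ idMap
        g≢id g≡id = kx≢jx (begin
          apply k x                               ≡⟨ sym (apply-invMapʳ d′ c′≢0 _) ⟩
          apply j (apply (invMap j) (apply k x))  ≡⟨ cong (apply j) (sym (apply-compose (invMap j) k x)) ⟩
          apply j (apply g x)                     ≡⟨ cong (λ h → apply j (apply h x)) g≡id ⟩
          apply j (apply idMap x)                 ≡⟨ cong (apply j) (apply-idMap x) ⟩
          apply j x                               ∎)
        a∈A : A a ≡ true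
        a∈A = proj₂ (proj₂ (Admissible-compose (Admissible-invMap j-adm) k-adm)) g≢id a a∈F g-fixes-a
        kx-jx≡ : (c * x + d) - (c′ * x + d′) ≡ u * (x - a)
        kx-jx≡ = begin
          (c * x + d) - (c′ * x + d′)
            ≡⟨ solve 5 (λ c c′ x d d′ → (c :* x :+ d) :- (c′ :* x :+ d′) := (c :- c′) :* x :- (d′ :- d))
                 refl c c′ x d d′ ⟩
          u * x - (d′ - d)
            ≡⟨ cong (λ w → u * x - w) (sym ua≡d′-d) ⟩
          u * x - u * a
            ≡⟨ solve 3 (λ u x a → u :* x :- u :* a := u :* (x :- a)) refl u x a ⟩
          u * (x - a) ∎

      preimage-in-A : ∀ {k a} → IsAGL k → A a ≡ true → Adj (apply k x) a → ∃[ b ] A b ≡ true × apply k b ≡ a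
      preimage-in-A {k} {a} k∈AGL a∈A (_ , _ , inj₁ kx-a∈F) =
        ⊥-elim (apply-x∉F k∈AGL (subst InFr kx≡ (InFr-+ kx-a∈F (A⊆F a a∈A))))
        where kx≡ = solve 2 (λ y a → (y :- a) :+ a := y) refl (apply k x) a
      preimage-in-A {c , d} {a} (c∈F , d∈F , _) a∈A (_ , _ , inj₂ (b , b∈A , t , t∈F , _ , kx-a≡)) =
        b , b∈A , (begin
          c * b + d                  ≡⟨ solve 4 (λ c b d a → c :* b :+ d := (c :* b :+ (d :- a)) :+ a) refl c b d a ⟩
          (c * b + (d - a)) + a      ≡⟨ cong₂ (λ u v → (u * b + v) + a) c≡t d-a≡-tb ⟩
          (t * b + - (t * b)) + a    ≡⟨ cong (_+ a) (-‿inverseʳ (t * b)) ⟩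
          0# + a                     ≡⟨ +-identityˡ a ⟩
          a                          ∎)
        where
        kx-a≡′ : c * x + (d - a) ≡ t * x + - (t * b)
        kx-a≡′ = begin
          c * x + (d - a)       ≡⟨ solve 4 (λ c x d a → c :* x :+ (d :- a) := (c :* x :+ d) :- a) refl c x d a ⟩
          (c * x + d) - a       ≡⟨ kx-a≡ ⟩
          t * (x - b)           ≡⟨ solve 3 (λ t x b → t :* (x :- b) := t :* x :- t :* b) refl t x b ⟩
          t * x - t * b         ∎
        coefficients = independent-over-F c∈F (InFr-difference d∈F (A⊆F a a∈A))
                                          t∈F (InFr-‿ (InFr-* t∈F (A⊆F b b∈A))) kx-a≡′
        c≡t = proj₁ coefficients
        d-a≡-tb = proj₂ coefficients

      -- y is the image of x under a translation (if y - x ∈ F) or under the homothety with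
      -- centre a ∈ A and ratio 1 + t (if y - x = t (x - a)).
      adjacent-to-x⇒image : ∀ {y} → ¬ InFr y → Adj y x → ∃[ k ] IsAGL k × FixedPointsInA k × apply k x ≡ y
      adjacent-to-x⇒image {y} _ (_ , y-x≢0 , inj₁ y-x∈F) =
        (1# , y - x) , (InFr-1 , y-x∈F , 1≢0) , fixed , solve 2 (λ x y → :1 :* x :+ (y :- x) := y) refl x y
        where
        fixed : FixedPointsInA (1# , y - x)
        fixed _ b _ fixes-b = ⊥-elim (y-x≢0 (cong proj₂ (fixing-slope-1⇒idMap b refl fixes-b)))
      adjacent-to-x⇒image {y} y∉F (_ , _ , inj₂ (a , a∈A , t , t∈F , t≢0 , y-x≡)) =
        k , (InFr-+ InFr-1 t∈F , d∈F , 1+t≢0) , fixed , kx≡y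
        where
        a∈F = A⊆F a a∈A
        d∈F = InFr-‿ (InFr-* t∈F a∈F)
        k = (1# + t , - (t * a))
        kx≡y : apply k x ≡ y
        kx≡y = begin
          (1# + t) * x + - (t * a)
            ≡⟨ solve 3 (λ t x a → (:1 :+ t) :* x :- t :* a := x :+ t :* (x :- a)) refl t x a ⟩
          x + t * (x - a)           ≡⟨ cong (x +_) (sym y-x≡) ⟩
          x + (y - x)               ≡⟨ solve 2 (λ x y → x :+ (y :- x) := y) refl x y ⟩
          y                         ∎
        1+t≢0 : 1# + t ≢ 0#
        1+t≢0 1+t≡0 = y∉F (subst InFr (begin
          - (t * a)                  ≡⟨ sym (+-identityˡ _) ⟩
          0# + - (t * a)             ≡⟨ cong (_+ - (t * a)) (sym (zeroˡ x)) ⟩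
          0# * x + - (t * a)         ≡⟨ cong (λ u → u * x + - (t * a)) (sym 1+t≡0) ⟩
          (1# + t) * x + - (t * a)   ≡⟨ kx≡y ⟩
          y                          ∎) d∈F)
        t[b-a]≡0 : ∀ {b} → apply k b ≡ b → t * (b - a) ≡ 0#
        t[b-a]≡0 {b} fixes-b = begin
          t * (b - a)
            ≡⟨ solve 3 (λ t b a → t :* (b :- a) := ((:1 :+ t) :* b :- t :* a) :- b) refl t b a ⟩
          ((1# + t) * b + - (t * a)) - b   ≡⟨ cong (_- b) fixes-b ⟩
          b - b                            ≡⟨ -‿inverseʳ b ⟩
          0#                               ∎
        fixed : FixedPointsInA k
        fixed _ b _ fixes-b with *≡0⇒ (t[b-a]≡0 fixes-b)
        ... | inj₁ t≡0   = ⊥-elim (t≢0 t≡0)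
        ... | inj₂ b-a≡0 = subst (λ z → A z ≡ true) (sym (x∙y⁻¹≈ε⇒x≈y _ _ b-a≡0)) a∈A

      module MaximalClique (C : Carrier → Bool) (C-max : IsMaximalClique C) (C-⊇ : ContainsXAndXperpL C) where

        C-clique : IsClique C
        C-clique = proj₁ C-max

        x∈C : C x ≡ true
        x∈C = proj₁ C-⊇

        A⊆C : ∀ {a} → A a ≡ true → C a ≡ true
        A⊆C {a} a∈A = proj₂ C-⊇ a (A⊆F a a∈A) (inj₂ (Adj-x-A a∈A))

        C∩F⊆A : ∀ {y} → C y ≡ true → InFr y → A y ≡ true
        C∩F⊆A {y} y∈C y∈F with C-clique x y x∈C y∈C (λ x≡y → x∉F (subst InFr (sym x≡y) y∈F))
        ... | _ , _ , inj₁ x-y∈F = ⊥-elim (x∉F (subst InFr x≡ (InFr-+ x-y∈F y∈F)))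
          where x≡ = solve 2 (λ x y → (x :- y) :+ y := x) refl x y
        ... | _ , _ , inj₂ (a , a∈A , t , t∈F , _ , x-y≡) = subst (λ z → A z ≡ true) (sym y≡a) a∈A
          where
          a∈F = A⊆F a a∈A
          coefficients : 1# ≡ t × - y ≡ - (t * a)
          coefficients = independent-over-F InFr-1 (InFr-‿ y∈F) t∈F (InFr-‿ (InFr-* t∈F a∈F)) (begin
            1# * x - y       ≡⟨ cong (_- y) (*-identityˡ x) ⟩
            x - y            ≡⟨ x-y≡ ⟩
            t * (x - a)      ≡⟨ solve 3 (λ t x a → t :* (x :- a) := t :* x :- t :* a) refl t x a ⟩
            t * x - t * a    ∎)
          y≡a : y ≡ a
          y≡a = begin
            y                ≡⟨ sym (-‿involutive y) ⟩
            - (- y)          ≡⟨ cong -_ (proj₂ coefficients) ⟩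
            - (- (t * a))    ≡⟨ -‿involutive _ ⟩
            t * a            ≡⟨ cong (_* a) (sym (proj₁ coefficients)) ⟩
            1# * a           ≡⟨ *-identityˡ a ⟩
            a                ∎

        -- k x is adjacent to every a ∈ A, which gives A ⊆ k(A); as A is finite, k(A) = A.
        ∈C⇒Stabilises : ∀ {k} → IsAGL k → C (apply k x) ≡ true → Stabilises k
        ∈C⇒Stabilises {k} k∈AGL kx∈C z _ = bool-ext k⁻¹-preserves k-preserves
          where
          A⊆image : ∀ a → A a ≡ true → ∃[ b ] A b ≡ true × apply k b ≡ a
          A⊆image a a∈A = preimage-in-A k∈AGL a∈A (C-clique _ a kx∈C (A⊆C a∈A) kx≢a)
            where
            kx≢a : apply k x ≢ a
            kx≢a kx≡a = apply-x∉F k∈AGL (subst InFr (sym kx≡a) (A⊆F a a∈A))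
          k⁻¹-preserves : A (apply k z) ≡ true → A z ≡ true
          k⁻¹-preserves kz∈A with A⊆image (apply k z) kz∈A
          ... | b , b∈A , kb≡kz = subst (λ w → A w ≡ true) (apply-injective k∈AGL kb≡kz) b∈A
          k-preserves : A z ≡ true → A (apply k z) ≡ true
          k-preserves = ⊆-image⇒image-⊆ unique complete A (apply k) (apply-injective k∈AGL) A⊆image z

        C∖F⊆images : ∀ {y} → C y ≡ true → ¬ InFr y → ∃[ k ] Admissible k × apply k x ≡ y
        C∖F⊆images {y} y∈C y∉F with y ≟ x
        ... | yes y≡x = idMap , Admissible-idMap , trans (apply-idMap x) (sym y≡x)
        ... | no y≢x with adjacent-to-x⇒image y∉F (C-clique y x y∈C x∈C y≢x)
        ...   | k , k∈AGL , k-fixed , kx≡y = k , (k∈AGL , k-stab , k-fixed) , kx≡y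
          where k-stab = ∈C⇒Stabilises k∈AGL (subst (λ w → C w ≡ true) (sym kx≡y) y∈C)

        -- C ∪ {k x} is again a clique, so k x ∈ C by maximality.
        images⊆C : ∀ {k} → Admissible k → C (apply k x) ≡ true
        images⊆C {k} k-adm = proj₂ C-max D D-clique C⊆D q q∈D
          where
          q = apply k x
          D : Carrier → Bool
          D z = does (z ≟ q) ∨ C z
          C⊆D : ∀ z → C z ≡ true → D z ≡ true
          C⊆D z z∈C = subst (λ b → does (z ≟ q) ∨ b ≡ true) (sym z∈C) (∨-zeroʳ _)
          q∈D : D q ≡ true
          q∈D with q ≟ q
          ... | yes _  = refl
          ... | no q≢q = ⊥-elim (q≢q refl)
          D⇒ : ∀ {z} → D z ≡ true → z ≡ q ⊎ C z ≡ true
          D⇒ {z} z∈D with z ≟ q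
          ... | yes z≡q = inj₁ z≡q
          ... | no _    = inj₂ z∈D
          Adj-q : ∀ {v} → C v ≡ true → q ≢ v → Adj q v
          Adj-q {v} v∈C q≢v with InFr? v
          ... | yes v∈F = Adj-image-A k-adm (C∩F⊆A v∈C v∈F)
          ... | no v∉F with C∖F⊆images v∈C v∉F
          ...   | j , j-adm , refl = Adj-images k-adm j-adm q≢v
          D-clique : IsClique D
          D-clique u v u∈D v∈D u≢v with D⇒ u∈D | D⇒ v∈D
          ... | inj₁ refl | inj₁ refl = ⊥-elim (u≢v refl)
          ... | inj₁ refl | inj₂ v∈C  = Adj-q v∈C u≢v
          ... | inj₂ u∈C  | inj₁ refl = Adj-sym (Adj-q u∈C (≢-sym u≢v))
          ... | inj₂ u∈C  | inj₂ v∈C  = C-clique u v u∈C v∈C u≢v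

        sendsXIntoC : Pair → Bool
        sendsXIntoC g = does (IsAGL? g) ∧ C (apply g x)

        Admissible⇒sendsXIntoC : ∀ {g} → Admissible g → sendsXIntoC g ≡ true
        Admissible⇒sendsXIntoC {g} g-adm = cong₂ _∧_ (dec-true (IsAGL? g) (proj₁ g-adm)) (images⊆C g-adm)

        sendsXIntoC⇒IsAGL : ∀ {g} → sendsXIntoC g ≡ true → IsAGL g
        sendsXIntoC⇒IsAGL {g} g∈H = does≡true⇒ (IsAGL? g) (∧-conicalˡ (does (IsAGL? g)) _ g∈H)

        sendsXIntoC⇒Admissible : ∀ {g} → sendsXIntoC g ≡ true → Admissible g
        sendsXIntoC⇒Admissible {g} g∈H with C∖F⊆images (∧-conicalʳ (does (IsAGL? g)) _ g∈H) (apply-x∉F g∈AGL)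
          where g∈AGL = sendsXIntoC⇒IsAGL g∈H
        ... | k , k-adm , kx≡gx =
          subst Admissible (apply-x-injective (proj₁ k-adm) (sendsXIntoC⇒IsAGL g∈H) kx≡gx) k-adm

        sendsXIntoC-IsSubgroupAGL : IsSubgroupAGL sendsXIntoC
        sendsXIntoC-IsSubgroupAGL =
          (λ g g∈H → proj₁ (admissible g∈H)) ,
          Admissible⇒sendsXIntoC Admissible-idMap ,
          (λ g h g∈H h∈H → Admissible⇒sendsXIntoC (Admissible-compose (admissible g∈H) (admissible h∈H))) ,
          (λ g g∈H → Admissible⇒sendsXIntoC (Admissible-invMap (admissible g∈H)))
          where admissible = sendsXIntoC⇒Admissible

        sendsXIntoC-PropertyI : PropertyI sendsXIntoC A
        sendsXIntoC-PropertyI =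
          (λ g g∈H z z∈A → trans (proj₁ (proj₂ (admissible g∈H)) z (A⊆F z z∈A)) z∈A) ,
          (λ g g∈H → proj₂ (proj₂ (admissible g∈H)))
          where admissible = sendsXIntoC⇒Admissible

        isFr : Carrier → Bool
        isFr z = does (InFr? z)

        C∧isFr≗A : ∀ z → C z ∧ isFr z ≡ A z
        C∧isFr≗A z with InFr? z | A z in z∈A?
        ... | yes z∈F | _     = trans (∧-identityʳ (C z)) (bool-ext C⇒A A⇒C)
          where
          C⇒A = λ z∈C → trans (sym z∈A?) (C∩F⊆A z∈C z∈F)
          A⇒C = λ z∈A → A⊆C (trans z∈A? z∈A)
        ... | no z∉F  | true  = ⊥-elim (z∉F (A⊆F z z∈A?))
        ... | no _    | false = ∧-zeroʳ (C z)

        -- g ↦ g x is a bijection from G onto C ∖ F.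
        count-C : ∀ (G : Pair → Bool) →
          (∀ {g} → G g ≡ true → Admissible g) → (∀ {g} → Admissible g → G g ≡ true) →
          count C ≡ count A ℕ.+ countPairs G
        count-C G G⊆Admissible Admissible⊆G = begin
          count C                   ≡⟨ length-filterᵇ-split C isFr elems ⟩
          count C∩F ℕ.+ count C∖F   ≡⟨ cong₂ ℕ._+_ (cong length (filterᵇ-cong C∩F C∧isFr≗A elems))
                                                  (sym |G|≡|C∖F|) ⟩
          count A ℕ.+ countPairs G  ∎
          where
          C∩F C∖F : Carrier → Bool
          C∩F z = C z ∧ isFr z
          C∖F z = C z ∧ not (isFr z)
          pairs = cartesianProduct elems elems
          admissible : ∀ {g} → g ∈ filterᵇ G pairs → Admissible g
          admissible g∈ = G⊆Admissible (proj₂ (∈-filterᵇ⁻ G pairs g∈))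
          into : ∀ {g} → g ∈ filterᵇ G pairs → apply g x ∈ filterᵇ C∖F elems
          into {g} g∈ = ∈-filterᵇ⁺ C∖F (complete _) (cong₂ _∧_ (images⊆C (admissible g∈)) (cong not gx∉F))
            where gx∉F = dec-false (InFr? (apply g x)) (apply-x∉F (proj₁ (admissible g∈)))
          onto : ∀ {y} → y ∈ filterᵇ C∖F elems → ∃[ g ] g ∈ filterᵇ G pairs × apply g x ≡ y
          onto {y} y∈ with C∖F⊆images (∧-conicalˡ _ _ y∈C∖F) y∉F
            where
            y∈C∖F = proj₂ (∈-filterᵇ⁻ C∖F elems y∈)
            y∉F = not-does≡true⇒¬ (InFr? y) (∧-conicalʳ (C y) _ y∈C∖F)
          ... | k@(c , d) , k-adm , kx≡y =
            k , ∈-filterᵇ⁺ G (∈-cartesianProduct⁺ (complete c) (complete d)) (Admissible⊆G k-adm) , kx≡y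
          |G|≡|C∖F| : countPairs G ≡ count C∖F
          |G|≡|C∖F| = length-≡-of-bijection (λ g → apply g x)
            (Unique.filter⁺ (λ g → T? (G g)) (Unique.cartesianProduct⁺ unique unique))
            (Unique.filter⁺ (λ z → T? (C∖F z)) unique)
            (λ g∈ g′∈ → apply-x-injective (proj₁ (admissible g∈)) (proj₁ (admissible g′∈)))
            into onto

open import Data.Nat using (_+_; _*_; _∸_; _^_; _<_; _≤_)

proposition8 : (p r k m h f : ℕ) → Prime p → 1 ≤ k → r ≡ p ^ k →
    2 < m → m < r ∸ 1 → 1 ≤ h →
    h ∣ gcd (r ∸ 1) (gcd (m ∸ 2) (p ^ f ∸ 1)) → p ^ f ∣ gcd r (m ∸ 1) →
    (K : FiniteField) → length (FiniteField.elems K) ≡ r * r →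
    (A : FiniteField.Carrier K → Bool) →
    (∀ z → A z ≡ true → FF.Sub.InFr K r z) →
    FF.count K A ≡ m ∸ 1 →
    (G : FF.Pair K → Bool) → FF.Sub.IsSubgroupAGL K r G →
    FF.countPairs K G ≡ h * p ^ f →
    FF.Sub.PropertyI K r G A →
    (∀ H → FF.Sub.IsSubgroupAGL K r H → (∀ g → G g ≡ true → H g ≡ true) →
       FF.Sub.PropertyI K r H A → ∀ g → H g ≡ true → G g ≡ true) →
    (x : FiniteField.Carrier K) → ¬ FF.Sub.InFr K r x →
    (C : FiniteField.Carrier K → Bool) →
    FF.Sub.Net.IsMaximalClique K r A x C →
    FF.Sub.Net.ContainsXAndXperpL K r A x C →
    FF.count K C ≡ (m ∸ 1) + h * p ^ f
proposition8 p r k m h f p-prime 1≤k r≡pᵏ _ _ _ _ _ K card A A⊆F |A|≡m-1 G G-subgroup |G|≡hpᶠ G-I G-maximal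
             x x∉F C C-max C-⊇ = begin
  FF.count K C                        ≡⟨ count-C G G⊆Admissible Admissible⊆G ⟩
  FF.count K A + FF.countPairs K G    ≡⟨ cong₂ _+_ |A|≡m-1 |G|≡hpᶠ ⟩
  (m ∸ 1) + h * p ^ f                 ∎
  where
  open ≡-Reasoning
  open FixedField K p-prime 1≤k r≡pᵏ card
  open Admissibility A
  open PointOutsideFr A⊆F x x∉F
  open MaximalClique C C-max C-⊇
  G⊆Admissible : ∀ {g} → G g ≡ true → Admissible g
  G⊆Admissible = PropertyI⇒Admissible G-subgroup G-I
  Admissible⊆G : ∀ {g} → Admissible g → G g ≡ true
  Admissible⊆G g-adm = G-maximal sendsXIntoC sendsXIntoC-IsSubgroupAGL
    (λ _ g∈G → Admissible⇒sendsXIntoC (G⊆Admissible g∈G)) sendsXIntoC-PropertyI _ (Admissible⇒sendsXIntoC g-adm)
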